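{- Let $G_n$ be the random unipolar graph on $\{1,\dots,n\}$ with associated partition $C_0,C_1,\dots,C_k$ as generated by the scheme described in the context. With high probability it holds that, for every vertex $v$: $v\in C_0$ if and only if the neighbourhood $N(v)$ of $v$ in $G_n$ contains a stable set of size three.
   Context: The random graph $G_n$ (McDiarmid–Yolov scheme) is generated as follows: choose $m\in[n]$ with probability proportional to $\binom{n}{m}2^{m(n-m)}B(n-m)$, where $B(\cdot)$ denotes the Bell numbers, and let $C_0$ be a uniformly random $m$-subset of $[n]=\{1,\dots,n\}$; take a uniformly random set partition $[n]\setminus C_0=C_1\cup\dots\cup C_k$; make each $C_i$ ($0\le i\le k$) a clique; add each edge between $C_0$ and $[n]\setminus C_0$ independently with probability $1/2$; add no further edges. A sequence of events $E_n$ holds with high probability if $\Pr(E_n)\to1$ as $n\to\infty$. -}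

module Defs where

open import Data.Nat using (ℕ; zero; suc; _+_; _<ᵇ_; _≤ᵇ_)
open import Data.Bool using (Bool; true; false; _∧_; _∨_; not; _xor_; if_then_else_)
open import Data.Fin using (Fin; toℕ)
open import Data.Fin.Properties using (_≟_)
open import Data.Vec using (Vec; lookup; []; _∷_)
open import Data.List using (List; []; _∷_; [_]; map; concatMap; allFin)
open import Data.Bool.ListAction using (all; any)
open import Relation.Nullary.Decidable using (⌊_⌋)

_==_ : ∀ {n} → Fin n → Fin n → Bool
a == b = ⌊ a ≟ b ⌋

vecsOf : ∀ {A : Set} → List A → (k : ℕ) → List (Vec A k)
vecsOf xs zero    = [ [] ]
vecsOf xs (suc k) = concatMap (λ x → map (x ∷_) (vecsOf xs k)) xs

count : ∀ {A : Set} → (A → Bool) → List A → ℕ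
count p []       = 0
count p (x ∷ xs) = (if p x then 1 else 0) + count p xs

-- An outcome of the McDiarmid–Yolov scheme on vertex set Fin n = [n]:
--  * inC0 v        : whether v ∈ C₀;
--  * rep v         : for v ∉ C₀, the least element of the block C_i containing v
--                    (this encodes the set partition of [n] ∖ C₀ bijectively);
--                    canonically rep v = v for v ∈ C₀;
--  * bip u v       : for u ∈ C₀, v ∉ C₀, whether the edge uv is present;
--                    canonically false otherwise.
record Outcome (n : ℕ) : Set where
  constructor outcome
  field
    inC0 : Vec Bool n
    rep  : Vec (Fin n) n
    bip  : Vec (Vec Bool n) n

module _ {n : ℕ} (o : Outcome n) where
  open Outcome o

  C0 : Fin n → Bool
  C0 v = lookup inC0 v

  r : Fin n → Fin n
  r v = lookup rep v

  b : Fin n → Fin n → Bool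
  b u v = lookup (lookup bip u) v

  valid : Bool
  valid =
    any C0 (allFin n)
    ∧ all (λ v → if C0 v
                 then r v == v
                 else (not (C0 (r v)) ∧ (toℕ (r v) ≤ᵇ toℕ v) ∧ (r (r v) == r v)))
          (allFin n)
    ∧ all (λ u → all (λ v → not (b u v) ∨ (C0 u ∧ not (C0 v))) (allFin n)) (allFin n)

  adj : Fin n → Fin n → Bool
  adj u v =
    not (u == v)
    ∧ ((C0 u ∧ C0 v)
       ∨ (not (C0 u) ∧ not (C0 v) ∧ (r u == r v))
       ∨ b u v
       ∨ b v u)

  nbhdHasStable3 : Fin n → Bool
  nbhdHasStable3 v =
    any (λ x → any (λ y → any (λ z →
          (toℕ x <ᵇ toℕ y) ∧ (toℕ y <ᵇ toℕ z)
          ∧ adj v x ∧ adj v y ∧ adj v z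
          ∧ not (adj x y) ∧ not (adj x z) ∧ not (adj y z))
        (allFin n)) (allFin n)) (allFin n)

  goodEvent : Bool
  goodEvent = all (λ v → not (C0 v xor nbhdHasStable3 v)) (allFin n)

allOutcomes : (n : ℕ) → List (Outcome n)
allOutcomes n =
  concatMap (λ c → concatMap (λ p → map (outcome c p)
                  (vecsOf (vecsOf (true ∷ false ∷ []) n) n))
              (vecsOf (allFin n) n))
            (vecsOf (true ∷ false ∷ []) n)

-- Under the scheme, every valid outcome has probability exactly
-- 1 / Σ_m C(n,m) 2^{m(n-m)} B(n-m), i.e. the distribution is uniform on
-- valid outcomes. Hence Pr(event fails) = badCount n / totalCount n.
totalCount : ℕ → ℕ
totalCount n = count (λ o → valid o) (allOutcomes n)

badCount : ℕ → ℕ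
badCount n = count (λ o → valid o ∧ not (goodEvent o)) (allOutcomes n)

-- A vertex outside C₀ is adjacent only to vertices of C₀ and of its own block, two cliques, so its
-- neighbourhood contains no stable set of size three. The b block representatives are pairwise
-- non-adjacent, so a vertex of C₀ can only fail when at most two of them are joined to it, which
-- happens for at most (b + 1)² of every 2^b choices of its cross edges. Hence partitions with at
-- least L blocks contribute at most n (L + 1)² 2^-L · totalCount bad outcomes. Partitions with fewer
-- than L blocks number at most 2^n L^n and carry at most 2^(⌊n/2⌋⌈n/2⌉) edge choices each, while
-- taking C₀ = [0, n/2) and about n/4 singleton blocks that the remaining vertices join already gives
-- (n/4)^(n/4) · 2^(⌊n/2⌋⌈n/2⌉) valid outcomes. For L ≈ n^(1/5) both contributions are at most
-- totalCount / (2k).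

{-# OPTIONS --safe #-}
module Submission where

open import Defs
open import Data.Nat using (ℕ; zero; suc; pred; _+_; _*_; _∸_; _^_; _≤_; _<_; z≤n; s≤s; _<ᵇ_; _≤ᵇ_; ⌊_/2⌋; ⌈_/2⌉; NonZero; >-nonZero)
open import Data.Nat.Properties hiding (_≟_; suc-injective)
open import Data.Nat.Tactic.RingSolver using (solve-∀)
open import Data.Bool using (Bool; true; false; _∧_; _∨_; not; _xor_; if_then_else_)
open import Data.Bool.Properties using (∧-conicalˡ; ∧-conicalʳ; ∧-assoc; ∧-zeroʳ; ∧-identityʳ; ∨-zeroʳ; not-injective; ¬-not; T-≡)
open import Data.Fin using (Fin; toℕ) renaming (zero to fzero; suc to fsuc)
open import Data.Fin.Properties using (_≟_; suc-injective)
open import Data.Vec using (Vec; lookup; []; _∷_; tabulate)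
open import Data.Vec.Properties using (lookup∘tabulate)
open import Data.List using (List; []; _∷_; map; concatMap; allFin; _++_)
import Data.List as List
open import Data.Bool.ListAction using (all; any)
open import Data.Product using (∃-syntax; _×_; _,_; proj₁)
open import Data.Sum using (_⊎_; inj₁; inj₂)
open import Data.Empty using (⊥; ⊥-elim)
open import Relation.Nullary using (yes; no)
open import Relation.Binary.PropositionalEquality
open import Function using (_∘_; id)
open import Function.Bundles using (module Equivalence)

𝟙 : Bool → ℕ
𝟙 b = if b then 1 else 0

𝟙-∧ : ∀ a b → 𝟙 (a ∧ b) ≡ 𝟙 a * 𝟙 b
𝟙-∧ true  b = sym (+-identityʳ (𝟙 b))
𝟙-∧ false b = refl

𝟙-∨ : ∀ a b → 𝟙 (a ∨ b) ≤ 𝟙 a + 𝟙 b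
𝟙-∨ true  b = s≤s z≤n
𝟙-∨ false b = ≤-refl

𝟙-mono : ∀ {a b} → (a ≡ true → b ≡ true) → 𝟙 a ≤ 𝟙 b
𝟙-mono {true}  a⇒b rewrite a⇒b refl = ≤-refl
𝟙-mono {false} a⇒b = z≤n

true≢false : true ≢ false
true≢false ()

<⇒<ᵇ≡true : ∀ {m n} → m < n → (m <ᵇ n) ≡ true
<⇒<ᵇ≡true m<n = Equivalence.to T-≡ (<⇒<ᵇ m<n)

<ᵇ≡true⇒< : ∀ {m n} → (m <ᵇ n) ≡ true → m < n
<ᵇ≡true⇒< {m} {n} eq = <ᵇ⇒< m n (Equivalence.from T-≡ eq)

<ᵇ≡false⇒≥ : ∀ m n → (m <ᵇ n) ≡ false → n ≤ m
<ᵇ≡false⇒≥ m       zero    _  = z≤n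
<ᵇ≡false⇒≥ (suc m) (suc n) eq = s≤s (<ᵇ≡false⇒≥ m n eq)

≤⇒≤ᵇ≡true : ∀ {m n} → m ≤ n → (m ≤ᵇ n) ≡ true
≤⇒≤ᵇ≡true m≤n = Equivalence.to T-≡ (≤⇒≤ᵇ m≤n)

if-true : ∀ {A : Set} {b} (x y : A) → b ≡ true → (if b then x else y) ≡ x
if-true x y refl = refl

if-false : ∀ {A : Set} {b} (x y : A) → b ≡ false → (if b then x else y) ≡ y
if-false x y refl = refl

module _ {n : ℕ} where

  ==-refl : (a : Fin n) → (a == a) ≡ true
  ==-refl a with a ≟ a
  ... | yes _  = refl
  ... | no a≢a = ⊥-elim (a≢a refl)

  ≡⇒== : {a b : Fin n} → a ≡ b → (a == b) ≡ true
  ≡⇒== {a} refl = ==-refl a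

  ==⇒≡ : {a b : Fin n} → (a == b) ≡ true → a ≡ b
  ==⇒≡ {a} {b} eq with a ≟ b
  ... | yes a≡b = a≡b

  ≢⇒==false : {a b : Fin n} → a ≢ b → (a == b) ≡ false
  ≢⇒==false {a} {b} a≢b with a ≟ b
  ... | yes a≡b = ⊥-elim (a≢b a≡b)
  ... | no _    = refl

sumMap : {A : Set} → (A → ℕ) → List A → ℕ
sumMap f []       = 0
sumMap f (x ∷ xs) = f x + sumMap f xs

module _ {A : Set} where

  count≡sumMap𝟙 : (P : A → Bool) (xs : List A) → count P xs ≡ sumMap (𝟙 ∘ P) xs
  count≡sumMap𝟙 P []       = refl
  count≡sumMap𝟙 P (x ∷ xs) = cong (𝟙 (P x) +_) (count≡sumMap𝟙 P xs)

  sumMap-++ : (f : A → ℕ) (xs ys : List A) → sumMap f (xs ++ ys) ≡ sumMap f xs + sumMap f ys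
  sumMap-++ f []       ys = refl
  sumMap-++ f (x ∷ xs) ys = trans (cong (f x +_) (sumMap-++ f xs ys)) (sym (+-assoc (f x) _ _))

  sumMap-cong : {f g : A → ℕ} (xs : List A) → (∀ x → f x ≡ g x) → sumMap f xs ≡ sumMap g xs
  sumMap-cong []       f≗g = refl
  sumMap-cong (x ∷ xs) f≗g = cong₂ _+_ (f≗g x) (sumMap-cong xs f≗g)

  sumMap-mono : {f g : A → ℕ} (xs : List A) → (∀ x → f x ≤ g x) → sumMap f xs ≤ sumMap g xs
  sumMap-mono []       f≤g = z≤n
  sumMap-mono (x ∷ xs) f≤g = +-mono-≤ (f≤g x) (sumMap-mono xs f≤g)

  sumMap-zero : (xs : List A) → sumMap (λ _ → 0) xs ≡ 0
  sumMap-zero []       = refl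
  sumMap-zero (x ∷ xs) = sumMap-zero xs

  sumMap-+ : (f g : A → ℕ) (xs : List A) → sumMap (λ x → f x + g x) xs ≡ sumMap f xs + sumMap g xs
  sumMap-+ f g []       = refl
  sumMap-+ f g (x ∷ xs) rewrite sumMap-+ f g xs = interchange (f x) (g x) (sumMap f xs) (sumMap g xs)
    where
    interchange : ∀ a b c d → a + b + (c + d) ≡ a + c + (b + d)
    interchange = solve-∀

  sumMap-*ˡ : (c : ℕ) (f : A → ℕ) (xs : List A) → sumMap (λ x → c * f x) xs ≡ c * sumMap f xs
  sumMap-*ˡ c f []       = sym (*-zeroʳ c)
  sumMap-*ˡ c f (x ∷ xs) rewrite sumMap-*ˡ c f xs = sym (*-distribˡ-+ c (f x) (sumMap f xs))

  sumMap-*ʳ : (c : ℕ) (f : A → ℕ) (xs : List A) → sumMap (λ x → f x * c) xs ≡ sumMap f xs * c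
  sumMap-*ʳ c f xs = trans (sumMap-cong xs (λ x → *-comm (f x) c)) (trans (sumMap-*ˡ c f xs) (*-comm c _))

  count-cong : {P Q : A → Bool} (xs : List A) → (∀ x → P x ≡ Q x) → count P xs ≡ count Q xs
  count-cong {P} {Q} xs P≗Q rewrite count≡sumMap𝟙 P xs | count≡sumMap𝟙 Q xs = sumMap-cong xs (cong 𝟙 ∘ P≗Q)

  count-mono : {P Q : A → Bool} (xs : List A) → (∀ x → P x ≡ true → Q x ≡ true) → count P xs ≤ count Q xs
  count-mono {P} {Q} xs P⇒Q rewrite count≡sumMap𝟙 P xs | count≡sumMap𝟙 Q xs = sumMap-mono xs (𝟙-mono ∘ P⇒Q)

  count-false : (xs : List A) → count (λ _ → false) xs ≡ 0
  count-false []       = refl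
  count-false (x ∷ xs) = count-false xs

  count-const∧ : (b : Bool) (P : A → Bool) (xs : List A) → count (λ x → b ∧ P x) xs ≡ 𝟙 b * count P xs
  count-const∧ true  P xs = sym (+-identityʳ _)
  count-const∧ false P xs = count-false xs

module _ {A B : Set} where

  sumMap-map : (f : B → ℕ) (g : A → B) (xs : List A) → sumMap f (map g xs) ≡ sumMap (f ∘ g) xs
  sumMap-map f g []       = refl
  sumMap-map f g (x ∷ xs) = cong (f (g x) +_) (sumMap-map f g xs)

  sumMap-concatMap : (f : B → ℕ) (g : A → List B) (xs : List A) →
                     sumMap f (concatMap g xs) ≡ sumMap (λ x → sumMap f (g x)) xs
  sumMap-concatMap f g []       = refl
  sumMap-concatMap f g (x ∷ xs) =
    trans (sumMap-++ f (g x) (concatMap g xs)) (cong (sumMap f (g x) +_) (sumMap-concatMap f g xs))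

  sumMap-swap : (f : A → B → ℕ) (xs : List A) (ys : List B) →
                sumMap (λ x → sumMap (f x) ys) xs ≡ sumMap (λ y → sumMap (λ x → f x y) xs) ys
  sumMap-swap f []       ys = sym (sumMap-zero ys)
  sumMap-swap f (x ∷ xs) ys =
    trans (cong (sumMap (f x) ys +_) (sumMap-swap f xs ys)) (sym (sumMap-+ (f x) (λ y → sumMap (λ x → f x y) xs) ys))

∑ : ∀ {n} → (Fin n → ℕ) → ℕ
∑ {zero}  f = 0
∑ {suc n} f = f fzero + ∑ (f ∘ fsuc)

∏ : ∀ {n} → (Fin n → ℕ) → ℕ
∏ {zero}  f = 1
∏ {suc n} f = f fzero * ∏ (f ∘ fsuc)

⋀ : ∀ {n} → (Fin n → Bool) → Bool
⋀ {zero}  P = true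
⋀ {suc n} P = P fzero ∧ ⋀ (P ∘ fsuc)

⋁ : ∀ {n} → (Fin n → Bool) → Bool
⋁ {zero}  P = false
⋁ {suc n} P = P fzero ∨ ⋁ (P ∘ fsuc)

∣_∣ : ∀ {n} → (Fin n → Bool) → ℕ
∣ P ∣ = ∑ (𝟙 ∘ P)

module _ {A : Set} where

  count-tabulate : ∀ {n} (P : A → Bool) (f : Fin n → A) → count P (List.tabulate f) ≡ ∣ P ∘ f ∣
  count-tabulate {zero}  P f = refl
  count-tabulate {suc n} P f = cong (𝟙 (P (f fzero)) +_) (count-tabulate P (f ∘ fsuc))

  all-tabulate : ∀ {n} (P : A → Bool) (f : Fin n → A) → all P (List.tabulate f) ≡ ⋀ (P ∘ f)
  all-tabulate {zero}  P f = refl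
  all-tabulate {suc n} P f = cong (P (f fzero) ∧_) (all-tabulate P (f ∘ fsuc))

  any-tabulate : ∀ {n} (P : A → Bool) (f : Fin n → A) → any P (List.tabulate f) ≡ ⋁ (P ∘ f)
  any-tabulate {zero}  P f = refl
  any-tabulate {suc n} P f = cong (P (f fzero) ∨_) (any-tabulate P (f ∘ fsuc))

⋀-elim : ∀ {n} {P : Fin n → Bool} → ⋀ P ≡ true → ∀ i → P i ≡ true
⋀-elim {suc n}     all-P fzero    = ∧-conicalˡ _ _ all-P
⋀-elim {suc n} {P} all-P (fsuc i) = ⋀-elim (∧-conicalʳ (P fzero) _ all-P) i

all-allFin-elim : ∀ {n} {P : Fin n → Bool} → all P (allFin n) ≡ true → ∀ i → P i ≡ true
all-allFin-elim {P = P} all-P = ⋀-elim (trans (sym (all-tabulate P id)) all-P)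

⋀-intro : ∀ {n} {P : Fin n → Bool} → (∀ i → P i ≡ true) → ⋀ P ≡ true
⋀-intro {zero}  _     = refl
⋀-intro {suc n} all-P = cong₂ _∧_ (all-P fzero) (⋀-intro (all-P ∘ fsuc))

⋀≡false⇒∃ : ∀ {n} {P : Fin n → Bool} → ⋀ P ≡ false → ∃[ i ] P i ≡ false
⋀≡false⇒∃ {suc n} {P} not-all with P fzero in eq
... | false = fzero , eq
... | true  with ⋀≡false⇒∃ {P = P ∘ fsuc} not-all
...   | i , Pi = fsuc i , Pi

⋀-cong : ∀ {n} {P Q : Fin n → Bool} → (∀ i → P i ≡ Q i) → ⋀ P ≡ ⋀ Q
⋀-cong {zero}  _   = refl
⋀-cong {suc n} P≗Q = cong₂ _∧_ (P≗Q fzero) (⋀-cong (P≗Q ∘ fsuc))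

⋁-cong : ∀ {n} {P Q : Fin n → Bool} → (∀ i → P i ≡ Q i) → ⋁ P ≡ ⋁ Q
⋁-cong {zero}  _   = refl
⋁-cong {suc n} P≗Q = cong₂ _∨_ (P≗Q fzero) (⋁-cong (P≗Q ∘ fsuc))

⋁-intro : ∀ {n} {P : Fin n → Bool} (i : Fin n) → P i ≡ true → ⋁ P ≡ true
⋁-intro {P = P} fzero    Pi rewrite Pi = refl
⋁-intro {P = P} (fsuc i) Pi rewrite ⋁-intro {P = P ∘ fsuc} i Pi = ∨-zeroʳ (P fzero)

⋁-false : ∀ {n} {P : Fin n → Bool} → (∀ i → P i ≡ false) → ⋁ P ≡ false
⋁-false {zero}      _    = refl
⋁-false {suc n} {P} none rewrite none fzero = ⋁-false (none ∘ fsuc)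

∑-cong : ∀ {n} {f g : Fin n → ℕ} → (∀ i → f i ≡ g i) → ∑ f ≡ ∑ g
∑-cong {zero}  _   = refl
∑-cong {suc n} f≗g = cong₂ _+_ (f≗g fzero) (∑-cong (f≗g ∘ fsuc))

∑-mono : ∀ {n} {f g : Fin n → ℕ} → (∀ i → f i ≤ g i) → ∑ f ≤ ∑ g
∑-mono {zero}  _   = z≤n
∑-mono {suc n} f≤g = +-mono-≤ (f≤g fzero) (∑-mono (f≤g ∘ fsuc))

∑-const : ∀ {n} c → ∑ {n} (λ _ → c) ≡ n * c
∑-const {zero}  c = refl
∑-const {suc n} c = cong (c +_) (∑-const {n} c)

∑-*ˡ : ∀ {n} c (f : Fin n → ℕ) → ∑ (λ i → c * f i) ≡ c * ∑ f
∑-*ˡ {zero}  c f = sym (*-zeroʳ c)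
∑-*ˡ {suc n} c f rewrite ∑-*ˡ c (f ∘ fsuc) = sym (*-distribˡ-+ c (f fzero) _)

∑-*ʳ : ∀ {n} c (f : Fin n → ℕ) → ∑ (λ i → f i * c) ≡ ∑ f * c
∑-*ʳ c f = trans (∑-cong (λ i → *-comm (f i) c)) (trans (∑-*ˡ c f) (*-comm c _))

∏-cong : ∀ {n} {f g : Fin n → ℕ} → (∀ i → f i ≡ g i) → ∏ f ≡ ∏ g
∏-cong {zero}  _   = refl
∏-cong {suc n} f≗g = cong₂ _*_ (f≗g fzero) (∏-cong (f≗g ∘ fsuc))

∏-mono : ∀ {n} {f g : Fin n → ℕ} → (∀ i → f i ≤ g i) → ∏ f ≤ ∏ g
∏-mono {zero}  _   = ≤-refl
∏-mono {suc n} f≤g = *-mono-≤ (f≤g fzero) (∏-mono (f≤g ∘ fsuc))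

∏-const : ∀ {n} c → ∏ {n} (λ _ → c) ≡ c ^ n
∏-const {zero}  c = refl
∏-const {suc n} c = cong (c *_) (∏-const {n} c)

∏-^ : ∀ {n} c (f : Fin n → ℕ) → ∏ (λ i → c ^ f i) ≡ c ^ ∑ f
∏-^ {zero}  c f = refl
∏-^ {suc n} c f rewrite ∏-^ c (f ∘ fsuc) = sym (^-distribˡ-+-* c (f fzero) _)

∏-mono-except : ∀ {n} (v : Fin n) (f g : Fin n → ℕ) B C →
                (∀ u → u ≢ v → g u ≤ f u) → g v * B ≤ C * f v → ∏ g * B ≤ C * ∏ f
∏-mono-except {suc n} fzero f g B C g≤f gv≤ = begin
  g fzero * ∏ (g ∘ fsuc) * B  ≡⟨ swap₂₃ (g fzero) (∏ (g ∘ fsuc)) B ⟩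
  g fzero * B * ∏ (g ∘ fsuc)  ≤⟨ *-mono-≤ gv≤ (∏-mono (λ i → g≤f (fsuc i) (λ ()))) ⟩
  C * f fzero * ∏ (f ∘ fsuc)  ≡⟨ *-assoc C (f fzero) _ ⟩
  C * ∏ f                     ∎
  where
  open ≤-Reasoning
  swap₂₃ : ∀ a b c → a * b * c ≡ a * c * b
  swap₂₃ = solve-∀
∏-mono-except {suc n} (fsuc v) f g B C g≤f gv≤ = begin
  g fzero * ∏ (g ∘ fsuc) * B    ≡⟨ *-assoc (g fzero) _ B ⟩
  g fzero * (∏ (g ∘ fsuc) * B)  ≤⟨ *-mono-≤ (g≤f fzero (λ ())) (∏-mono-except v (f ∘ fsuc) (g ∘ fsuc) B C g≤f′ gv≤) ⟩
  f fzero * (C * ∏ (f ∘ fsuc))  ≡⟨ *-left-comm (f fzero) C _ ⟩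
  C * ∏ f                       ∎
  where
  open ≤-Reasoning
  g≤f′ : ∀ u → u ≢ v → g (fsuc u) ≤ f (fsuc u)
  g≤f′ u u≢v = g≤f (fsuc u) (u≢v ∘ suc-injective)
  *-left-comm : ∀ a b c → a * (b * c) ≡ b * (a * c)
  *-left-comm = solve-∀

∣∣+∣not∣≡n : ∀ {n} (P : Fin n → Bool) → ∣ P ∣ + ∣ not ∘ P ∣ ≡ n
∣∣+∣not∣≡n {zero}  P = refl
∣∣+∣not∣≡n {suc n} P with P fzero
... | true  = cong suc (∣∣+∣not∣≡n (P ∘ fsuc))
... | false = trans (+-suc ∣ P ∘ fsuc ∣ _) (cong suc (∣∣+∣not∣≡n (P ∘ fsuc)))

∣not∣≡n∸∣∣ : ∀ {n} (P : Fin n → Bool) → ∣ not ∘ P ∣ ≡ n ∸ ∣ P ∣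
∣not∣≡n∸∣∣ {n} P = trans (sym (m+n∸m≡n ∣ P ∣ _)) (cong (_∸ ∣ P ∣) (∣∣+∣not∣≡n P))

∣∣-∨ : ∀ {n} (P Q : Fin n → Bool) → ∣ (λ x → P x ∨ Q x) ∣ ≤ ∣ P ∣ + ∣ Q ∣
∣∣-∨ {zero}  P Q = z≤n
∣∣-∨ {suc n} P Q = begin
  𝟙 (P fzero ∨ Q fzero) + ∣ (λ x → P (fsuc x) ∨ Q (fsuc x)) ∣
    ≤⟨ +-mono-≤ (𝟙-∨ (P fzero) (Q fzero)) (∣∣-∨ (P ∘ fsuc) (Q ∘ fsuc)) ⟩
  𝟙 (P fzero) + 𝟙 (Q fzero) + (∣ P ∘ fsuc ∣ + ∣ Q ∘ fsuc ∣)
    ≡⟨ interchange (𝟙 (P fzero)) (𝟙 (Q fzero)) _ _ ⟩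
  ∣ P ∣ + ∣ Q ∣ ∎
  where
  open ≤-Reasoning
  interchange : ∀ a b c d → a + b + (c + d) ≡ a + c + (b + d)
  interchange = solve-∀

∣false∣≡0 : ∀ {n} → ∣ (λ (_ : Fin n) → false) ∣ ≡ 0
∣false∣≡0 {n} = trans (∑-const {n} 0) (*-zeroʳ n)

∣==∣≡1 : ∀ {n} (v : Fin n) → ∣ (λ x → x == v) ∣ ≡ 1
∣==∣≡1 {suc n} fzero =
  cong suc (trans (∑-cong {n} (λ i → cong 𝟙 (≢⇒==false {a = fsuc i} {b = fzero} λ ()))) (∣false∣≡0 {n}))
∣==∣≡1 {suc n} (fsuc v) rewrite ≢⇒==false {a = fzero} {b = fsuc v} (λ ()) =
  trans (∑-cong (λ i → cong 𝟙 (==-fsuc i))) (∣==∣≡1 v)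
  where
  ==-fsuc : ∀ i → (fsuc i == fsuc v) ≡ (i == v)
  ==-fsuc i with i == v in eq
  ... | true  = ≡⇒== (cong fsuc (==⇒≡ eq))
  ... | false = ≢⇒==false (λ i≡v → true≢false (trans (sym (≡⇒== (suc-injective i≡v))) eq))

∣∣-pos : ∀ {n} {P : Fin n → Bool} i → P i ≡ true → 1 ≤ ∣ P ∣
∣∣-pos {P = P} fzero    Pi rewrite Pi = s≤s z≤n
∣∣-pos {P = P} (fsuc i) Pi = ≤-trans (∣∣-pos {P = P ∘ fsuc} i Pi) (m≤n+m _ (𝟙 (P fzero)))

∣<ᵇ∣≡ : ∀ n t → t ≤ n → ∣ (λ (i : Fin n) → toℕ i <ᵇ t) ∣ ≡ t
∣<ᵇ∣≡ zero    zero    _         = refl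
∣<ᵇ∣≡ (suc n) zero    _         = ∣false∣≡0 {suc n}
∣<ᵇ∣≡ (suc n) (suc t) (s≤s t≤n) = cong suc (∣<ᵇ∣≡ n t t≤n)

∣interval∣≡ : ∀ n a t → a ≤ t → t ≤ n → ∣ (λ (i : Fin n) → (toℕ i <ᵇ t) ∧ not (toℕ i <ᵇ a)) ∣ ≡ t ∸ a
∣interval∣≡ n       zero    t       _         t≤n       =
  trans (∑-cong {n} (λ i → cong 𝟙 (∧-identityʳ (toℕ i <ᵇ t)))) (∣<ᵇ∣≡ n t t≤n)
∣interval∣≡ (suc n) (suc a) (suc t) (s≤s a≤t) (s≤s t≤n) = ∣interval∣≡ n a t a≤t t≤n

count-vecsOf-⋀ : ∀ {A : Set} (xs : List A) n (Q : Fin n → A → Bool) →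
                 count (λ w → ⋀ (λ i → Q i (lookup w i))) (vecsOf xs n) ≡ ∏ (λ i → count (Q i) xs)
count-vecsOf-⋀ xs zero    Q = refl
count-vecsOf-⋀ xs (suc n) Q = begin
  count P (vecsOf xs (suc n))
    ≡⟨ count≡sumMap𝟙 P (vecsOf xs (suc n)) ⟩
  sumMap (𝟙 ∘ P) (concatMap (λ x → map (x ∷_) (vecsOf xs n)) xs)
    ≡⟨ sumMap-concatMap (𝟙 ∘ P) (λ x → map (x ∷_) (vecsOf xs n)) xs ⟩
  sumMap (λ x → sumMap (𝟙 ∘ P) (map (x ∷_) (vecsOf xs n))) xs
    ≡⟨ sumMap-cong xs (λ x → sumMap-map (𝟙 ∘ P) (x ∷_) (vecsOf xs n)) ⟩
  sumMap (λ x → sumMap (λ w → 𝟙 (Q fzero x ∧ P′ w)) (vecsOf xs n)) xs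
    ≡⟨ sumMap-cong xs (λ x → sumMap-cong (vecsOf xs n) (λ w → 𝟙-∧ (Q fzero x) (P′ w))) ⟩
  sumMap (λ x → sumMap (λ w → 𝟙 (Q fzero x) * 𝟙 (P′ w)) (vecsOf xs n)) xs
    ≡⟨ sumMap-cong xs (λ x → sumMap-*ˡ (𝟙 (Q fzero x)) (𝟙 ∘ P′) (vecsOf xs n)) ⟩
  sumMap (λ x → 𝟙 (Q fzero x) * sumMap (𝟙 ∘ P′) (vecsOf xs n)) xs
    ≡⟨ sumMap-*ʳ _ (𝟙 ∘ Q fzero) xs ⟩
  sumMap (𝟙 ∘ Q fzero) xs * sumMap (𝟙 ∘ P′) (vecsOf xs n)
    ≡⟨ cong₂ _*_ (sym (count≡sumMap𝟙 (Q fzero) xs))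
      (trans (sym (count≡sumMap𝟙 P′ (vecsOf xs n))) (count-vecsOf-⋀ xs n (Q ∘ fsuc))) ⟩
  ∏ (λ i → count (Q i) xs)                                             ∎
  where
  open ≡-Reasoning
  P : Vec _ (suc n) → Bool
  P w = ⋀ (λ i → Q i (lookup w i))
  P′ : Vec _ n → Bool
  P′ w = ⋀ (λ i → Q (fsuc i) (lookup w i))

bools : List Bool
bools = true ∷ false ∷ []

sumMap-vecsOf-bools-suc : ∀ {n} (f : Vec Bool (suc n) → ℕ) →
                          sumMap f (vecsOf bools (suc n)) ≡
                          sumMap (f ∘ (true ∷_)) (vecsOf bools n) + sumMap (f ∘ (false ∷_)) (vecsOf bools n)
sumMap-vecsOf-bools-suc {n} f = begin
  sumMap f (concatMap (λ x → map (x ∷_) V) bools)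
    ≡⟨ sumMap-concatMap f (λ x → map (x ∷_) V) bools ⟩
  sumMap f (map (true ∷_) V) + (sumMap f (map (false ∷_) V) + 0)
    ≡⟨ cong₂ _+_ (sumMap-map f _ V) (trans (+-identityʳ _) (sumMap-map f _ V)) ⟩
  sumMap (f ∘ (true ∷_)) V + sumMap (f ∘ (false ∷_)) V ∎
  where
  open ≡-Reasoning
  V = vecsOf bools n

count-vecsOf-bools-suc : ∀ {n} (P : Vec Bool (suc n) → Bool) →
                         count P (vecsOf bools (suc n)) ≡
                         count (P ∘ (true ∷_)) (vecsOf bools n) + count (P ∘ (false ∷_)) (vecsOf bools n)
count-vecsOf-bools-suc {n} P
  rewrite count≡sumMap𝟙 P (vecsOf bools (suc n))
        | count≡sumMap𝟙 (P ∘ (true ∷_)) (vecsOf bools n)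
        | count≡sumMap𝟙 (P ∘ (false ∷_)) (vecsOf bools n) = sumMap-vecsOf-bools-suc (𝟙 ∘ P)

sumMap-vecsOf-bools-const : ∀ n K → sumMap (λ _ → K) (vecsOf bools n) ≡ 2 ^ n * K
sumMap-vecsOf-bools-const zero    K = trans (+-identityʳ K) (sym (*-identityˡ K))
sumMap-vecsOf-bools-const (suc n) K
  rewrite sumMap-vecsOf-bools-suc {n} (λ _ → K) | sumMap-vecsOf-bools-const n K = double (2 ^ n) K
  where
  double : ∀ a k → a * k + a * k ≡ 2 * a * k
  double = solve-∀

≤-sumMap-vecsOf-bools : ∀ {n} (f : Vec Bool n → ℕ) (w : Vec Bool n) → f w ≤ sumMap f (vecsOf bools n)
≤-sumMap-vecsOf-bools {zero}  f []      = m≤m+n (f []) 0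
≤-sumMap-vecsOf-bools {suc n} f (x ∷ w) rewrite sumMap-vecsOf-bools-suc f with x
... | true  = ≤-trans (≤-sumMap-vecsOf-bools (f ∘ (true ∷_)) w) (m≤m+n _ _)
... | false = ≤-trans (≤-sumMap-vecsOf-bools (f ∘ (false ∷_)) w) (m≤n+m _ _)

inC0Vecs : (n : ℕ) → List (Vec Bool n)
inC0Vecs n = vecsOf bools n

repVecs : (n : ℕ) → List (Vec (Fin n) n)
repVecs n = vecsOf (allFin n) n

bipMatrices : (n : ℕ) → List (Vec (Vec Bool n) n)
bipMatrices n = vecsOf (vecsOf bools n) n

sumCP : ∀ n → (Vec Bool n → Vec (Fin n) n → ℕ) → ℕ
sumCP n f = sumMap (λ c → sumMap (f c) (repVecs n)) (inC0Vecs n)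

module _ {n : ℕ} where

  sumCP-mono : {f g : Vec Bool n → Vec (Fin n) n → ℕ} → (∀ c p → f c p ≤ g c p) → sumCP n f ≤ sumCP n g
  sumCP-mono f≤g = sumMap-mono (inC0Vecs n) (λ c → sumMap-mono (repVecs n) (f≤g c))

  sumCP-+ : (f g : Vec Bool n → Vec (Fin n) n → ℕ) → sumCP n (λ c p → f c p + g c p) ≡ sumCP n f + sumCP n g
  sumCP-+ f g = trans (sumMap-cong (inC0Vecs n) (λ c → sumMap-+ (f c) (g c) (repVecs n)))
                      (sumMap-+ (λ c → sumMap (f c) (repVecs n)) (λ c → sumMap (g c) (repVecs n)) (inC0Vecs n))

  sumCP-*ˡ : (k : ℕ) (f : Vec Bool n → Vec (Fin n) n → ℕ) → sumCP n (λ c p → k * f c p) ≡ k * sumCP n f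
  sumCP-*ˡ k f = trans (sumMap-cong (inC0Vecs n) (λ c → sumMap-*ˡ k (f c) (repVecs n)))
                       (sumMap-*ˡ k (λ c → sumMap (f c) (repVecs n)) (inC0Vecs n))

  sumCP-*ʳ : (k : ℕ) (f : Vec Bool n → Vec (Fin n) n → ℕ) → sumCP n (λ c p → f c p * k) ≡ sumCP n f * k
  sumCP-*ʳ k f = trans (sumMap-cong (inC0Vecs n) (λ c → sumMap-*ʳ k (f c) (repVecs n)))
                       (sumMap-*ʳ k (λ c → sumMap (f c) (repVecs n)) (inC0Vecs n))

count-allOutcomes : ∀ n (P : Outcome n → Bool) →
                    count P (allOutcomes n) ≡ sumCP n (λ c p → count (λ M → P (outcome c p M)) (bipMatrices n))
count-allOutcomes n P = begin
  count P (allOutcomes n)                                            ≡⟨ count≡sumMap𝟙 P (allOutcomes n) ⟩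
  sumMap (𝟙 ∘ P) (allOutcomes n)                                     ≡⟨ sumMap-concatMap (𝟙 ∘ P) _ (inC0Vecs n) ⟩
  sumMap (λ c → sumMap (𝟙 ∘ P) (concatMap (λ p → map (outcome c p) (bipMatrices n)) (repVecs n))) (inC0Vecs n)
                                                                     ≡⟨ sumMap-cong (inC0Vecs n) per-c ⟩
  sumCP n (λ c p → count (λ M → P (outcome c p M)) (bipMatrices n)) ∎
  where
  open ≡-Reasoning
  per-c : ∀ c → sumMap (𝟙 ∘ P) (concatMap (λ p → map (outcome c p) (bipMatrices n)) (repVecs n))
              ≡ sumMap (λ p → count (λ M → P (outcome c p M)) (bipMatrices n)) (repVecs n)
  per-c c = trans (sumMap-concatMap (𝟙 ∘ P) _ (repVecs n))
                  (sumMap-cong (repVecs n) (λ p → trans (sumMap-map (𝟙 ∘ P) (outcome c p) (bipMatrices n))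
                                                        (sym (count≡sumMap𝟙 (λ M → P (outcome c p M)) (bipMatrices n)))))

module _ {n : ℕ} where

  C0-nonempty : Vec Bool n → Bool
  C0-nonempty c = any (lookup c) (allFin n)

  partitionAt : Vec Bool n → Vec (Fin n) n → Fin n → Bool
  partitionAt c p v = if lookup c v
                      then lookup p v == v
                      else (not (lookup c (lookup p v)) ∧ (toℕ (lookup p v) ≤ᵇ toℕ v) ∧ (lookup p (lookup p v) == lookup p v))

  isPartition : Vec Bool n → Vec (Fin n) n → Bool
  isPartition c p = all (partitionAt c p) (allFin n)

  allowedEdge : Vec Bool n → Fin n → Fin n → Bool → Bool
  allowedEdge c u w x = not x ∨ (lookup c u ∧ not (lookup c w))

  isCrossMatrix : Vec Bool n → Vec (Vec Bool n) n → Bool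
  isCrossMatrix c M = all (λ u → all (λ w → allowedEdge c u w (lookup (lookup M u) w)) (allFin n)) (allFin n)

  isCrossRow : Vec Bool n → Fin n → Vec Bool n → Bool
  isCrossRow c u row = ⋀ (λ w → allowedEdge c u w (lookup row w))

  isCrossMatrix≡⋀ : ∀ c M → isCrossMatrix c M ≡ ⋀ (λ u → isCrossRow c u (lookup M u))
  isCrossMatrix≡⋀ c M =
    trans (all-tabulate (λ u → all (λ w → allowedEdge c u w (lookup (lookup M u) w)) (allFin n)) id)
          (⋀-cong (λ u → all-tabulate (λ w → allowedEdge c u w (lookup (lookup M u) w)) id))

  crossCount : Vec Bool n → ℕ
  crossCount c = count (isCrossMatrix c) (bipMatrices n)

  crossCount≡∏ : ∀ c → crossCount c ≡ ∏ (λ u → count (isCrossRow c u) (vecsOf bools n))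
  crossCount≡∏ c = trans (count-cong (bipMatrices n) (isCrossMatrix≡⋀ c))
                         (count-vecsOf-⋀ (vecsOf bools n) n (isCrossRow c))

  crossCount≡2^ : ∀ c → crossCount c ≡ 2 ^ (∣ lookup c ∣ * ∣ not ∘ lookup c ∣)
  crossCount≡2^ c = begin
    crossCount c
      ≡⟨ crossCount≡∏ c ⟩
    ∏ (λ u → count (isCrossRow c u) (vecsOf bools n))
      ≡⟨ ∏-cong (λ u → count-vecsOf-⋀ bools n (allowedEdge c u)) ⟩
    ∏ (λ u → ∏ (λ w → count (allowedEdge c u w) bools))
      ≡⟨ ∏-cong (λ u → ∏-cong (λ w → count-allowed (lookup c u ∧ not (lookup c w)))) ⟩
    ∏ (λ u → ∏ (λ w → 2 ^ 𝟙 (lookup c u ∧ not (lookup c w))))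
      ≡⟨ ∏-cong {n} (λ u → ∏-^ {n} 2 _) ⟩
    ∏ (λ u → 2 ^ ∣ (λ w → lookup c u ∧ not (lookup c w)) ∣)
      ≡⟨ ∏-^ {n} 2 _ ⟩
    2 ^ ∑ (λ u → ∣ (λ w → lookup c u ∧ not (lookup c w)) ∣)
      ≡⟨ cong (2 ^_) exponent ⟩
    2 ^ (∣ lookup c ∣ * ∣ not ∘ lookup c ∣) ∎
    where
    open ≡-Reasoning
    count-allowed : ∀ b → count (λ x → not x ∨ b) bools ≡ 2 ^ 𝟙 b
    count-allowed true  = refl
    count-allowed false = refl
    exponent : ∑ (λ u → ∣ (λ w → lookup c u ∧ not (lookup c w)) ∣) ≡ ∣ lookup c ∣ * ∣ not ∘ lookup c ∣
    exponent = trans (∑-cong (λ u → trans (∑-cong (λ w → 𝟙-∧ (lookup c u) (not (lookup c w))))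
                                         (∑-*ˡ (𝟙 (lookup c u)) (𝟙 ∘ not ∘ lookup c))))
                     (∑-*ʳ ∣ not ∘ lookup c ∣ (𝟙 ∘ lookup c))

  count-valid : ∀ c p → count (λ M → valid (outcome c p M)) (bipMatrices n) ≡ 𝟙 (C0-nonempty c ∧ isPartition c p) * crossCount c
  count-valid c p = begin
    count (λ M → C0-nonempty c ∧ (isPartition c p ∧ isCrossMatrix c M)) (bipMatrices n)
      ≡⟨ count-const∧ (C0-nonempty c) _ (bipMatrices n) ⟩
    𝟙 (C0-nonempty c) * count (λ M → isPartition c p ∧ isCrossMatrix c M) (bipMatrices n)
      ≡⟨ cong (𝟙 (C0-nonempty c) *_) (count-const∧ (isPartition c p) (isCrossMatrix c) (bipMatrices n)) ⟩
    𝟙 (C0-nonempty c) * (𝟙 (isPartition c p) * crossCount c)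
      ≡⟨ *-assoc (𝟙 (C0-nonempty c)) _ _ ⟨
    𝟙 (C0-nonempty c) * 𝟙 (isPartition c p) * crossCount c
      ≡⟨ cong (_* crossCount c) (𝟙-∧ (C0-nonempty c) (isPartition c p)) ⟨
    𝟙 (C0-nonempty c ∧ isPartition c p) * crossCount c ∎
    where open ≡-Reasoning

⌈n/2⌉≤1+⌊n/2⌋ : ∀ n → ⌈ n /2⌉ ≤ suc ⌊ n /2⌋
⌈n/2⌉≤1+⌊n/2⌋ zero          = z≤n
⌈n/2⌉≤1+⌊n/2⌋ (suc zero)    = s≤s z≤n
⌈n/2⌉≤1+⌊n/2⌋ (suc (suc n)) = s≤s (⌈n/2⌉≤1+⌊n/2⌋ n)

balanced-*-max : ∀ m m′ a a′ → m + m′ ≡ a + a′ → a ≤ a′ → a′ ≤ suc a → m * m′ ≤ a * a′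
balanced-*-max m m′ a a′ eq a≤a′ a′≤1+a with ≤-<-connex m a
... | inj₁ m≤a with m≤n⇒∃[o]m+o≡n m≤a
...   | d , refl = begin
  m * m′
    ≡⟨ cong (m *_) m′≡a′+d ⟩
  m * (a′ + d)
    ≡⟨ *-distribˡ-+ m a′ d ⟩
  m * a′ + m * d
    ≤⟨ +-monoʳ-≤ (m * a′) (≤-trans (*-monoˡ-≤ d (≤-trans (m≤m+n m d) a≤a′)) (≤-reflexive (*-comm a′ d))) ⟩
  m * a′ + d * a′
    ≡⟨ *-distribʳ-+ a′ m d ⟨
  (m + d) * a′ ∎
  where
  open ≤-Reasoning
  m′≡a′+d : m′ ≡ a′ + d
  m′≡a′+d = +-cancelˡ-≡ m m′ (a′ + d) (trans eq (shuffle m d a′))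
    where
    shuffle : ∀ x y z → x + y + z ≡ x + (z + y)
    shuffle = solve-∀
balanced-*-max m m′ a a′ eq a≤a′ a′≤1+a | inj₂ a<m with m≤n⇒∃[o]m+o≡n a<m
...   | d , refl = begin
  (suc a + d) * m′       ≡⟨ expand a d m′ ⟩
  a * m′ + suc d * m′    ≤⟨ +-monoʳ-≤ (a * m′) (*-monoʳ-≤ (suc d) m′≤a) ⟩
  a * m′ + suc d * a     ≡⟨ collect a d m′ ⟩
  a * (suc d + m′)       ≡⟨ cong (a *_) a′≡1+d+m′ ⟨
  a * a′                 ∎
  where
  open ≤-Reasoning
  expand : ∀ a d m′ → (suc a + d) * m′ ≡ a * m′ + suc d * m′
  expand = solve-∀
  collect : ∀ a d m′ → a * m′ + suc d * a ≡ a * (suc d + m′)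
  collect = solve-∀
  a′≡1+d+m′ : a′ ≡ suc d + m′
  a′≡1+d+m′ = sym (+-cancelˡ-≡ a (suc d + m′) a′ (trans (shuffle a d m′) eq))
    where
    shuffle : ∀ a d m′ → a + (suc d + m′) ≡ suc a + d + m′
    shuffle = solve-∀
  m′≤a : m′ ≤ a
  m′≤a = ≤-pred (≤-trans (s≤s (m≤n+m m′ d)) (subst (_≤ suc a) a′≡1+d+m′ a′≤1+a))

crossCount≤2^⌊n/2⌋⌈n/2⌉ : ∀ {n} (c : Vec Bool n) → crossCount c ≤ 2 ^ (⌊ n /2⌋ * ⌈ n /2⌉)
crossCount≤2^⌊n/2⌋⌈n/2⌉ {n} c rewrite crossCount≡2^ c =
  ^-monoʳ-≤ 2 (balanced-*-max ∣ lookup c ∣ ∣ not ∘ lookup c ∣ ⌊ n /2⌋ ⌈ n /2⌉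
                 (trans (∣∣+∣not∣≡n (lookup c)) (sym (⌊n/2⌋+⌈n/2⌉≡n n))) (⌊n/2⌋≤⌈n/2⌉ n) (⌈n/2⌉≤1+⌊n/2⌋ n))

∣∣≥1⇒∃ : ∀ {n} {P : Fin n → Bool} → 1 ≤ ∣ P ∣ → ∃[ x ] P x ≡ true
∣∣≥1⇒∃ {suc n} {P} 1≤∣P∣ with P fzero in eq
... | true  = fzero , eq
... | false with ∣∣≥1⇒∃ {P = P ∘ fsuc} 1≤∣P∣
...   | x , Px = fsuc x , Px

∣∣≥2⇒∃< : ∀ {n} {P : Fin n → Bool} → 2 ≤ ∣ P ∣ →
          ∃[ x ] ∃[ y ] (toℕ x < toℕ y × P x ≡ true × P y ≡ true)
∣∣≥2⇒∃< {suc n} {P} 2≤∣P∣ with P fzero in eq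
... | true with ∣∣≥1⇒∃ {P = P ∘ fsuc} (≤-pred 2≤∣P∣)
...   | y , Py = fzero , fsuc y , s≤s z≤n , eq , Py
∣∣≥2⇒∃< {suc n} {P} 2≤∣P∣ | false with ∣∣≥2⇒∃< {P = P ∘ fsuc} 2≤∣P∣
...   | x , y , x<y , Px , Py = fsuc x , fsuc y , s≤s x<y , Px , Py

∣∣≥3⇒∃<< : ∀ {n} {P : Fin n → Bool} → 3 ≤ ∣ P ∣ →
           ∃[ x ] ∃[ y ] ∃[ z ] (toℕ x < toℕ y × toℕ y < toℕ z × P x ≡ true × P y ≡ true × P z ≡ true)
∣∣≥3⇒∃<< {suc n} {P} 3≤∣P∣ with P fzero in eq
... | true with ∣∣≥2⇒∃< {P = P ∘ fsuc} (≤-pred 3≤∣P∣)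
...   | y , z , y<z , Py , Pz = fzero , fsuc y , fsuc z , s≤s z≤n , s≤s y<z , eq , Py , Pz
∣∣≥3⇒∃<< {suc n} {P} 3≤∣P∣ | false with ∣∣≥3⇒∃<< {P = P ∘ fsuc} 3≤∣P∣
...   | x , y , z , x<y , y<z , Px , Py , Pz = fsuc x , fsuc y , fsuc z , s≤s x<y , s≤s y<z , Px , Py , Pz

module _ {n : ℕ} (o : Outcome n) where

  stableTriple : Fin n → Fin n → Fin n → Fin n → Bool
  stableTriple v x y z =
    (toℕ x <ᵇ toℕ y) ∧ (toℕ y <ᵇ toℕ z)
    ∧ adj o v x ∧ adj o v y ∧ adj o v z
    ∧ not (adj o x y) ∧ not (adj o x z) ∧ not (adj o y z)

  nbhdHasStable3≡⋁ : ∀ v → nbhdHasStable3 o v ≡ ⋁ (λ x → ⋁ (λ y → ⋁ (λ z → stableTriple v x y z)))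
  nbhdHasStable3≡⋁ v =
    trans (any-tabulate (λ x → any (λ y → any (λ z → stableTriple v x y z) (allFin n)) (allFin n)) id)
          (⋁-cong (λ x → trans (any-tabulate (λ y → any (λ z → stableTriple v x y z) (allFin n)) id)
                               (⋁-cong (λ y → any-tabulate (λ z → stableTriple v x y z) id))))

  record IsStableTriple (v x y z : Fin n) : Set where
    field
      x<y : toℕ x < toℕ y
      y<z : toℕ y < toℕ z
      vx  : adj o v x ≡ true
      vy  : adj o v y ≡ true
      vz  : adj o v z ≡ true
      ¬xy : adj o x y ≡ false
      ¬xz : adj o x z ≡ false
      ¬yz : adj o y z ≡ false

  stableTriple-elim : ∀ {v x y z} → stableTriple v x y z ≡ true → IsStableTriple v x y z
  stableTriple-elim {v} {x} {y} {z} t with toℕ x <ᵇ toℕ y in x<y | toℕ y <ᵇ toℕ z in y<z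
                                         | adj o v x in vx | adj o v y in vy | adj o v z in vz
                                         | adj o x y in xy | adj o x z in xz | adj o y z in yz
  ... | true | true | true | true | true | false | false | false =
    record { x<y = <ᵇ≡true⇒< x<y ; y<z = <ᵇ≡true⇒< y<z ; vx = vx ; vy = vy ; vz = vz ; ¬xy = xy ; ¬xz = xz ; ¬yz = yz }

  stableTriple-intro : ∀ {v x y z} → IsStableTriple v x y z → stableTriple v x y z ≡ true
  stableTriple-intro record { x<y = x<y ; y<z = y<z ; vx = vx ; vy = vy ; vz = vz ; ¬xy = ¬xy ; ¬xz = ¬xz ; ¬yz = ¬yz }
    rewrite <⇒<ᵇ≡true x<y | <⇒<ᵇ≡true y<z | vx | vy | vz | ¬xy | ¬xz | ¬yz = refl

  goodEvent≡false⇒∃ : goodEvent o ≡ false → ∃[ v ] not (C0 o v xor nbhdHasStable3 o v) ≡ false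
  goodEvent≡false⇒∃ bad = ⋀≡false⇒∃ (trans (sym (all-tabulate (λ v → not (C0 o v xor nbhdHasStable3 o v)) id)) bad)

isRep : ∀ {n} → Vec Bool n → Vec (Fin n) n → Fin n → Bool
isRep c p w = not (lookup c w) ∧ (lookup p w == w)

blockCount : ∀ {n} → Vec Bool n → Vec (Fin n) n → ℕ
blockCount c p = ∣ isRep c p ∣

module CrossOutcome {n : ℕ} (c : Vec Bool n) (p : Vec (Fin n) n) (M : Vec (Vec Bool n) n)
                    (cross : isCrossMatrix c M ≡ true) where

  private
    o : Outcome n
    o = outcome c p M

    bip : Fin n → Fin n → Bool
    bip u w = lookup (lookup M u) w

    distinct : ∀ {x y : Fin n} → toℕ x < toℕ y → x ≢ y
    distinct x<y refl = <-irrefl refl x<y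

    C0-separates : ∀ {x y} → lookup c x ≡ true → lookup c y ≡ false → x ≢ y
    C0-separates x∈C0 y∉C0 refl = true≢false (trans (sym x∈C0) y∉C0)

  bip⇒C0×¬C0 : ∀ u w → bip u w ≡ true → lookup c u ≡ true × lookup c w ≡ false
  bip⇒C0×¬C0 u w uw with all-allFin-elim (all-allFin-elim cross u) w
  ... | allowed rewrite uw with lookup c u | lookup c w
  ...   | true | false = refl , refl

  bip-from-outside : ∀ u w → lookup c u ≡ false → bip u w ≡ false
  bip-from-outside u w u∉C0 = ¬-not (λ uw → true≢false (trans (sym (proj₁ (bip⇒C0×¬C0 u w uw))) u∉C0))

  adj-in-C0 : ∀ x y → x ≢ y → lookup c x ≡ true → lookup c y ≡ true → adj o x y ≡ true
  adj-in-C0 x y x≢y x∈C0 y∈C0 rewrite ≢⇒==false x≢y | x∈C0 | y∈C0 = refl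

  adj-in-block : ∀ x y → x ≢ y → lookup c x ≡ false → lookup c y ≡ false → lookup p x ≡ lookup p y → adj o x y ≡ true
  adj-in-block x y x≢y x∉C0 y∉C0 px≡py rewrite ≢⇒==false x≢y | x∉C0 | y∉C0 | ≡⇒== px≡py = refl

  InC0OrBlockOf : Fin n → Fin n → Set
  InC0OrBlockOf v x = lookup c x ≡ true ⊎ (lookup c x ≡ false × lookup p v ≡ lookup p x)

  nbr-of-outside : ∀ v x → lookup c v ≡ false → adj o v x ≡ true → InC0OrBlockOf v x
  nbr-of-outside v x v∉C0 vx with lookup c x in x∈C0
  ... | true  = inj₁ refl
  ... | false rewrite v∉C0 | bip-from-outside v x v∉C0 | bip-from-outside x v x∈C0
                with lookup p v == lookup p x in pv≡px
  ...   | true  = inj₂ (refl , ==⇒≡ pv≡px)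
  ...   | false = ⊥-elim (true≢false (trans (sym vx) (∧-zeroʳ (not (v == x)))))

  outside⇒¬stable3 : ∀ v → lookup c v ≡ false → nbhdHasStable3 o v ≡ false
  outside⇒¬stable3 v v∉C0 =
    trans (nbhdHasStable3≡⋁ o v) (⋁-false λ x → ⋁-false λ y → ⋁-false λ z → ¬-not (no-triple x y z))
    where
    no-triple : ∀ x y z → stableTriple o v x y z ≢ true
    no-triple x y z t = pigeonhole (side vx) (side vy) (side vz)
      where
      open IsStableTriple (stableTriple-elim o {v} {x} {y} {z} t)
      side : ∀ {w} → adj o v w ≡ true → InC0OrBlockOf v w
      side = nbr-of-outside v _ v∉C0
      x≢y = distinct x<y
      y≢z = distinct y<z
      x≢z = distinct (<-trans x<y y<z)
      clash : ∀ {a} → a ≡ true → a ≡ false → ⊥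
      clash a≡t a≡f = true≢false (trans (sym a≡t) a≡f)
      pigeonhole : InC0OrBlockOf v x → InC0OrBlockOf v y → InC0OrBlockOf v z → ⊥
      pigeonhole (inj₁ x∈C0) (inj₁ y∈C0) _ = clash (adj-in-C0 x y x≢y x∈C0 y∈C0) ¬xy
      pigeonhole (inj₁ x∈C0) _ (inj₁ z∈C0) = clash (adj-in-C0 x z x≢z x∈C0 z∈C0) ¬xz
      pigeonhole _ (inj₁ y∈C0) (inj₁ z∈C0) = clash (adj-in-C0 y z y≢z y∈C0 z∈C0) ¬yz
      pigeonhole (inj₂ (x∉C0 , px)) (inj₂ (y∉C0 , py)) _ = clash (adj-in-block x y x≢y x∉C0 y∉C0 (trans (sym px) py)) ¬xy
      pigeonhole (inj₂ (x∉C0 , px)) _ (inj₂ (z∉C0 , pz)) = clash (adj-in-block x z x≢z x∉C0 z∉C0 (trans (sym px) pz)) ¬xz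
      pigeonhole _ (inj₂ (y∉C0 , py)) (inj₂ (z∉C0 , pz)) = clash (adj-in-block y z y≢z y∉C0 z∉C0 (trans (sym py) pz)) ¬yz

  rep-nbrs⇒stable3 : ∀ v → lookup c v ≡ true → 3 ≤ ∣ (λ w → isRep c p w ∧ bip v w) ∣ → nbhdHasStable3 o v ≡ true
  rep-nbrs⇒stable3 v v∈C0 three with ∣∣≥3⇒∃<< {P = λ w → isRep c p w ∧ bip v w} three
  ... | x , y , z , x<y , y<z , x-rep , y-rep , z-rep =
    trans (nbhdHasStable3≡⋁ o v) (⋁-intro x (⋁-intro y (⋁-intro z (stableTriple-intro o triple))))
    where
    outside : ∀ {w} → isRep c p w ∧ bip v w ≡ true → lookup c w ≡ false
    outside {w} w-rep = not-injective (∧-conicalˡ _ _ (∧-conicalˡ _ _ w-rep))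
    fixed : ∀ {w} → isRep c p w ∧ bip v w ≡ true → lookup p w ≡ w
    fixed {w} w-rep = ==⇒≡ (∧-conicalʳ (not (lookup c w)) _ (∧-conicalˡ _ _ w-rep))
    adjacent : ∀ {w} → isRep c p w ∧ bip v w ≡ true → adj o v w ≡ true
    adjacent {w} w-rep
      rewrite ≢⇒==false (C0-separates v∈C0 (outside w-rep)) | v∈C0 | outside w-rep | ∧-conicalʳ (isRep c p w) _ w-rep = refl
    nonadjacent : ∀ {a b} → a ≢ b → isRep c p a ∧ bip v a ≡ true → isRep c p b ∧ bip v b ≡ true → adj o a b ≡ false
    nonadjacent {a} {b} a≢b a-rep b-rep
      rewrite outside a-rep | outside b-rep
            | ≢⇒==false (λ pa≡pb → a≢b (trans (sym (fixed a-rep)) (trans pa≡pb (fixed b-rep))))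
            | bip-from-outside a b (outside a-rep) | bip-from-outside b a (outside b-rep) = ∧-zeroʳ (not (a == b))
    triple : IsStableTriple o v x y z
    triple = record
      { x<y = x<y ; y<z = y<z
      ; vx = adjacent x-rep ; vy = adjacent y-rep ; vz = adjacent z-rep
      ; ¬xy = nonadjacent (distinct x<y) x-rep y-rep
      ; ¬xz = nonadjacent (distinct (<-trans x<y y<z)) x-rep z-rep
      ; ¬yz = nonadjacent (distinct y<z) y-rep z-rep
      }

  ¬good⇒∃C0-vertex-without-stable3 : goodEvent o ≡ false → ∃[ v ] (lookup c v ≡ true × nbhdHasStable3 o v ≡ false)
  ¬good⇒∃C0-vertex-without-stable3 bad with goodEvent≡false⇒∃ o bad
  ... | v , mismatch = v , C0-case (lookup c v) (nbhdHasStable3 o v) mismatch (outside⇒¬stable3 v)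
    where
    C0-case : ∀ a s → not (a xor s) ≡ false → (a ≡ false → s ≡ false) → a ≡ true × s ≡ false
    C0-case true  false _        _        = refl , refl
    C0-case false s     mismatch outside⇒ = ⊥-elim (true≢false (trans (cong not (sym (outside⇒ refl))) mismatch))

-- Vertices of C₀ without a stable triple are rare

pascal-step : ∀ m j N N′ D → N * 2 ^ m ≤ suc m ^ j * D → N′ * 2 ^ m ≤ suc m ^ suc j * D →
              (N + N′) * (2 * 2 ^ m) ≤ suc (suc m) ^ suc j * (D + D)
pascal-step m j N N′ D N≤ N′≤ = begin
  (N + N′) * (2 * 2 ^ m)
    ≡⟨ distrib N N′ (2 ^ m) ⟩
  2 * (N * 2 ^ m + N′ * 2 ^ m)
    ≤⟨ *-monoʳ-≤ 2 (+-mono-≤ N≤ N′≤) ⟩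
  2 * (suc m ^ j * D + suc m ^ suc j * D)
    ≡⟨ collect (suc m ^ j) D m ⟩
  suc (suc m) * suc m ^ j * (D + D)
    ≤⟨ *-monoˡ-≤ (D + D) (*-monoʳ-≤ (suc (suc m)) (^-monoˡ-≤ j (n≤1+n (suc m)))) ⟩
  suc (suc m) ^ suc j * (D + D) ∎
  where
  open ≤-Reasoning
  distrib : ∀ x y z → (x + y) * (2 * z) ≡ 2 * (x * z + y * z)
  distrib = solve-∀
  collect : ∀ x d m → 2 * (x * d + suc m * x * d) ≡ suc (suc m) * x * (d + d)
  collect = solve-∀

module _ {n : ℕ} where

  rowWithin : (Fin n → Bool) → Vec Bool n → Bool
  rowWithin F row = ⋀ (λ w → not (lookup row w) ∨ F w)

  atMostOnesIn : (Fin n → Bool) → ℕ → Vec Bool n → Bool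
  atMostOnesIn R j row = ∣ (λ w → R w ∧ lookup row w) ∣ <ᵇ suc j

-- The rows with at most j ones on R use at most ∑_{i ≤ j} C(|R|, i) ≤ (|R| + 1)^j of the 2^|R| patterns on R.
binomial-tail : ∀ {n} (F R : Fin n → Bool) → (∀ w → R w ≡ true → F w ≡ true) → ∀ j →
                count (λ row → rowWithin F row ∧ atMostOnesIn R j row) (vecsOf bools n) * 2 ^ ∣ R ∣
                ≤ suc ∣ R ∣ ^ j * count (rowWithin F) (vecsOf bools n)
binomial-tail {zero}  F R R⊆F j = subst (1 ≤_) (sym (trans (*-identityʳ (1 ^ j)) (^-zeroˡ j))) ≤-refl
binomial-tail {suc n} F R R⊆F j
  rewrite count-vecsOf-bools-suc (λ row → rowWithin F row ∧ atMostOnesIn R j row)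
        | count-vecsOf-bools-suc (rowWithin F)
  = step (F fzero) (R fzero) (R⊆F fzero) j (binomial-tail (F ∘ fsuc) (R ∘ fsuc) (R⊆F ∘ fsuc))
  where
  V = vecsOf bools n
  m = ∣ R ∘ fsuc ∣
  within : Vec Bool n → Bool
  within = rowWithin (F ∘ fsuc)
  ones : Vec Bool n → ℕ
  ones row = ∣ (λ w → R (fsuc w) ∧ lookup row w) ∣
  N : ℕ → ℕ
  N j = count (λ row → within row ∧ (ones row <ᵇ suc j)) V
  D = count within V

  -- The goal once every row is split on its first entry, with f₀ = F 0 and r₀ = R 0.
  step : ∀ f₀ r₀ → (r₀ ≡ true → f₀ ≡ true) → ∀ j → (∀ j → N j * 2 ^ m ≤ suc m ^ j * D) →
         (count (λ row → (f₀ ∧ within row) ∧ (𝟙 (r₀ ∧ true) + ones row <ᵇ suc j)) V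
          + count (λ row → within row ∧ (𝟙 (r₀ ∧ false) + ones row <ᵇ suc j)) V) * 2 ^ (𝟙 r₀ + m)
         ≤ suc (𝟙 r₀ + m) ^ j * (count (λ row → f₀ ∧ within row) V + D)
  step f₀ true r₀⇒f₀ j tail with r₀⇒f₀ refl
  step .true true _ zero tail | refl = begin
    (count (λ row → within row ∧ false) V + N 0) * (2 * 2 ^ m)
      ≡⟨ cong (λ k → (k + N 0) * (2 * 2 ^ m)) (trans (count-cong V (∧-zeroʳ ∘ within)) (count-false V)) ⟩
    N 0 * (2 * 2 ^ m)
      ≡⟨ *-left-comm (N 0) 2 (2 ^ m) ⟩
    2 * (N 0 * 2 ^ m)
      ≤⟨ *-monoʳ-≤ 2 (tail 0) ⟩
    2 * (1 * D)
      ≡⟨ double D ⟩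
    1 * (D + D) ∎
    where
    open ≤-Reasoning
    *-left-comm : ∀ x y z → x * (y * z) ≡ y * (x * z)
    *-left-comm = solve-∀
    double : ∀ d → 2 * (1 * d) ≡ 1 * (d + d)
    double = solve-∀
  step .true true _ (suc j) tail | refl = pascal-step m j (N j) (N (suc j)) D (tail j) (tail (suc j))
  step true false _ j tail = begin
    (N j + N j) * 2 ^ m              ≡⟨ *-distribʳ-+ (2 ^ m) (N j) (N j) ⟩
    N j * 2 ^ m + N j * 2 ^ m        ≤⟨ +-mono-≤ (tail j) (tail j) ⟩
    suc m ^ j * D + suc m ^ j * D    ≡⟨ *-distribˡ-+ (suc m ^ j) D D ⟨
    suc m ^ j * (D + D)              ∎
    where open ≤-Reasoning
  step false false _ j tail rewrite count-false V = tail j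

sumMap-∑ : ∀ {A : Set} {n} (f : Fin n → A → ℕ) (xs : List A) →
           sumMap (λ x → ∑ (λ v → f v x)) xs ≡ ∑ (λ v → sumMap (f v) xs)
sumMap-∑ {n = zero}  f xs = sumMap-zero xs
sumMap-∑ {n = suc n} f xs =
  trans (sumMap-+ (f fzero) (λ x → ∑ (λ v → f (fsuc v) x)) xs) (cong (sumMap (f fzero) xs +_) (sumMap-∑ (f ∘ fsuc) xs))

union-bound : ∀ {A : Set} {n} (P : A → Bool) (Q : Fin n → A → Bool) (xs : List A) →
              (∀ x → P x ≡ true → ∃[ v ] Q v x ≡ true) → count P xs ≤ ∑ (λ v → count (Q v) xs)
union-bound P Q xs P⇒∃Q = begin
  count P xs                          ≡⟨ count≡sumMap𝟙 P xs ⟩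
  sumMap (𝟙 ∘ P) xs                   ≤⟨ sumMap-mono xs pointwise ⟩
  sumMap (λ x → ∑ (λ v → 𝟙 (Q v x))) xs ≡⟨ sumMap-∑ (λ v x → 𝟙 (Q v x)) xs ⟩
  ∑ (λ v → sumMap (𝟙 ∘ Q v) xs)       ≡⟨ ∑-cong (λ v → count≡sumMap𝟙 (Q v) xs) ⟨
  ∑ (λ v → count (Q v) xs)            ∎
  where
  open ≤-Reasoning
  pointwise : ∀ x → 𝟙 (P x) ≤ ∑ (λ v → 𝟙 (Q v x))
  pointwise x with P x in Px
  ... | false = z≤n
  ... | true with P⇒∃Q x Px
  ...   | v , Qvx = ∣∣-pos {P = λ v → Q v x} v Qvx

[1+b]²/2^b-antitone : ∀ L b → 2 ≤ L → L ≤ b → suc b ^ 2 * 2 ^ L ≤ suc L ^ 2 * 2 ^ b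
[1+b]²/2^b-antitone L b 2≤L L≤b with m≤n⇒∃[o]m+o≡n L≤b
... | d , refl = go d
  where
  [2+m]²≤2[1+m]² : ∀ m → 2 ≤ m → suc (suc m) ^ 2 ≤ 2 * suc m ^ 2
  [2+m]²≤2[1+m]² m 2≤m = begin
    suc (suc m) ^ 2          ≡⟨ expand m ⟩
    m * m + 4 * m + 4        ≤⟨ +-monoʳ-≤ (m * m + 4 * m) (≤-trans (*-mono-≤ 2≤m 2≤m) (m≤n+m (m * m) 2)) ⟩
    m * m + 4 * m + (2 + m * m) ≡⟨ collect m ⟩
    2 * suc m ^ 2            ∎
    where
    open ≤-Reasoning
    expand : ∀ m → suc (suc m) * (suc (suc m) * 1) ≡ m * m + 4 * m + 4
    expand = solve-∀
    collect : ∀ m → m * m + 4 * m + (2 + m * m) ≡ 2 * (suc m * (suc m * 1))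
    collect = solve-∀
  go : ∀ d → suc (L + d) ^ 2 * 2 ^ L ≤ suc L ^ 2 * 2 ^ (L + d)
  go zero rewrite +-identityʳ L = ≤-refl
  go (suc d) rewrite +-suc L d = begin
    suc (suc (L + d)) ^ 2 * 2 ^ L      ≤⟨ *-monoˡ-≤ (2 ^ L) ([2+m]²≤2[1+m]² (L + d) (≤-trans 2≤L (m≤m+n L d))) ⟩
    2 * suc (L + d) ^ 2 * 2 ^ L        ≡⟨ *-assoc 2 (suc (L + d) ^ 2) (2 ^ L) ⟩
    2 * (suc (L + d) ^ 2 * 2 ^ L)      ≤⟨ *-monoʳ-≤ 2 (go d) ⟩
    2 * (suc L ^ 2 * 2 ^ (L + d))      ≡⟨ *-left-comm 2 (suc L ^ 2) (2 ^ (L + d)) ⟩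
    suc L ^ 2 * 2 ^ suc (L + d)        ∎
    where
    open ≤-Reasoning
    *-left-comm : ∀ x y z → x * (y * z) ≡ y * (x * z)
    *-left-comm = solve-∀

module _ {n : ℕ} where

  failsAt : Vec Bool n → Vec (Fin n) n → Fin n → Vec (Vec Bool n) n → Bool
  failsAt c p v M = isCrossMatrix c M ∧ (lookup c v ∧ not (nbhdHasStable3 (outcome c p M) v))

  -- By rep-nbrs⇒stable3 the row of a failing v has at most two ones on the block representatives;
  -- every other row is an arbitrary cross row.
  count-failsAt≤ : ∀ c p v → lookup c v ≡ true →
                   count (failsAt c p v) (bipMatrices n) * 2 ^ blockCount c p ≤ suc (blockCount c p) ^ 2 * crossCount c
  count-failsAt≤ c p v v∈C0 = begin
    count (failsAt c p v) (bipMatrices n) * 2 ^ B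
      ≤⟨ *-monoˡ-≤ (2 ^ B) (count-mono (bipMatrices n) fails⇒rows) ⟩
    count (λ M → ⋀ (λ u → rowOK u (lookup M u))) (bipMatrices n) * 2 ^ B
      ≡⟨ cong (_* 2 ^ B) (count-vecsOf-⋀ (vecsOf bools n) n rowOK) ⟩
    ∏ (λ u → count (rowOK u) (vecsOf bools n)) * 2 ^ B
      ≤⟨ ∏-mono-except v _ _ (2 ^ B) (suc B ^ 2) other-rows row-v ⟩
    suc B ^ 2 * ∏ (λ u → count (isCrossRow c u) (vecsOf bools n))
      ≡⟨ cong (suc B ^ 2 *_) (crossCount≡∏ c) ⟨
    suc B ^ 2 * crossCount c ∎
    where
    open ≤-Reasoning
    B = blockCount c p
    F : Fin n → Bool
    F w = lookup c v ∧ not (lookup c w)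
    rowOK : Fin n → Vec Bool n → Bool
    rowOK u = if u == v then (λ row → rowWithin F row ∧ atMostOnesIn (isRep c p) 2 row) else isCrossRow c u
    fails⇒rows : ∀ M → failsAt c p v M ≡ true → ⋀ (λ u → rowOK u (lookup M u)) ≡ true
    fails⇒rows M fails = ⋀-intro row-ok
      where
      cross = ∧-conicalˡ _ _ fails
      cross-rows = ⋀-elim (trans (sym (isCrossMatrix≡⋀ c M)) cross)
      no-stable3 = not-injective (∧-conicalʳ (lookup c v) _ (∧-conicalʳ (isCrossMatrix c M) _ fails))
      row-ok : ∀ u → rowOK u (lookup M u) ≡ true
      row-ok u with u == v in u==v
      ... | false = cross-rows u
      ... | true with ==⇒≡ u==v
      ...   | refl with ∣ (λ w → isRep c p w ∧ lookup (lookup M u) w) ∣ <ᵇ 3 in few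
      ...     | true  = cong₂ _∧_ (cross-rows u) refl
      ...     | false = ⊥-elim (true≢false (trans (sym (CrossOutcome.rep-nbrs⇒stable3 c p M cross u v∈C0
                                                           (<ᵇ≡false⇒≥ _ 3 few))) no-stable3))
    other-rows : ∀ u → u ≢ v → count (rowOK u) (vecsOf bools n) ≤ count (isCrossRow c u) (vecsOf bools n)
    other-rows u u≢v rewrite ≢⇒==false u≢v = ≤-refl
    row-v : count (rowOK v) (vecsOf bools n) * 2 ^ B ≤ suc B ^ 2 * count (isCrossRow c v) (vecsOf bools n)
    row-v rewrite ==-refl v = binomial-tail F (isRep c p) (λ w w-rep → cong₂ _∧_ v∈C0 (∧-conicalˡ _ _ w-rep)) 2

ratio-trans : ∀ X Y A B C m .{{_ : NonZero B}} → X * B ≤ A * m → A * Y ≤ C * B → X * Y ≤ C * m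
ratio-trans X Y A B C m XB≤Am AY≤CB = *-cancelʳ-≤ (X * Y) (C * m) B (begin
  X * Y * B      ≡⟨ swap₂₃ X Y B ⟩
  X * B * Y      ≤⟨ *-monoˡ-≤ Y XB≤Am ⟩
  A * m * Y      ≡⟨ regroup A m Y ⟩
  m * (A * Y)    ≤⟨ *-monoʳ-≤ m AY≤CB ⟩
  m * (C * B)    ≡⟨ regroup′ m C B ⟩
  C * m * B      ∎)
  where
  open ≤-Reasoning
  swap₂₃ : ∀ x y z → x * y * z ≡ x * z * y
  swap₂₃ = solve-∀
  regroup : ∀ x y z → x * y * z ≡ y * (x * z)
  regroup = solve-∀
  regroup′ : ∀ x y z → x * (y * z) ≡ y * x * z
  regroup′ = solve-∀

module _ {n : ℕ} where

  count-failsAt≤[1+L]²/2^L : ∀ L → 2 ≤ L → ∀ c p v → L ≤ blockCount c p →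
                             count (failsAt c p v) (bipMatrices n) * 2 ^ L ≤ suc L ^ 2 * crossCount c
  count-failsAt≤[1+L]²/2^L L 2≤L c p v L≤B = by-membership (lookup c v) refl
    where
    by-membership : ∀ b → lookup c v ≡ b → count (failsAt c p v) (bipMatrices n) * 2 ^ L ≤ suc L ^ 2 * crossCount c
    by-membership true v∈C0 =
      ratio-trans (count (failsAt c p v) (bipMatrices n)) (2 ^ L) (suc (blockCount c p) ^ 2) (2 ^ blockCount c p)
                  (suc L ^ 2) (crossCount c) {{m^n≢0 2 (blockCount c p)}}
                  (count-failsAt≤ c p v v∈C0) ([1+b]²/2^b-antitone L (blockCount c p) 2≤L L≤B)
    by-membership false v∉C0 = ≤-trans (≤-reflexive (cong (_* 2 ^ L) none)) z≤n
      where
      none : count (failsAt c p v) (bipMatrices n) ≡ 0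
      none = trans (count-cong (bipMatrices n)
                                (λ M → trans (cong (λ b → isCrossMatrix c M ∧ (b ∧ not (nbhdHasStable3 (outcome c p M) v))) v∉C0)
                                             (∧-zeroʳ (isCrossMatrix c M))))
                   (count-false (bipMatrices n))

  badAt : Vec Bool n → Vec (Fin n) n → Vec (Vec Bool n) n → Bool
  badAt c p M = valid (outcome c p M) ∧ not (goodEvent (outcome c p M))

  validCount : Vec Bool n → Vec (Fin n) n → ℕ
  validCount c p = count (λ M → valid (outcome c p M)) (bipMatrices n)

  badAt⇒isCrossMatrix : ∀ c p M → badAt c p M ≡ true → isCrossMatrix c M ≡ true
  badAt⇒isCrossMatrix c p M bad = ∧-conicalʳ (isPartition c p) _ (∧-conicalʳ (C0-nonempty c) _ (∧-conicalˡ _ _ bad))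

  fewBlocks : ℕ → Vec Bool n → Vec (Fin n) n → Bool
  fewBlocks L c p = isPartition c p ∧ (blockCount c p <ᵇ L)

  count-badAt≤-manyBlocks : ∀ L → 2 ≤ L → ∀ c p → L ≤ blockCount c p →
                            count (badAt c p) (bipMatrices n) * 2 ^ L ≤ n * (suc L ^ 2 * crossCount c)
  count-badAt≤-manyBlocks L 2≤L c p L≤B = begin
    count (badAt c p) (bipMatrices n) * 2 ^ L
      ≤⟨ *-monoˡ-≤ (2 ^ L) (union-bound (badAt c p) (failsAt c p) (bipMatrices n) bad⇒fails) ⟩
    ∑ (λ v → count (failsAt c p v) (bipMatrices n)) * 2 ^ L
      ≡⟨ ∑-*ʳ {n} (2 ^ L) _ ⟨
    ∑ (λ v → count (failsAt c p v) (bipMatrices n) * 2 ^ L)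
      ≤⟨ ∑-mono (λ v → count-failsAt≤[1+L]²/2^L L 2≤L c p v L≤B) ⟩
    ∑ {n} (λ _ → suc L ^ 2 * crossCount c)
      ≡⟨ ∑-const {n} _ ⟩
    n * (suc L ^ 2 * crossCount c) ∎
    where
    open ≤-Reasoning
    bad⇒fails : ∀ M → badAt c p M ≡ true → ∃[ v ] failsAt c p v M ≡ true
    bad⇒fails M bad with CrossOutcome.¬good⇒∃C0-vertex-without-stable3 c p M (badAt⇒isCrossMatrix c p M bad)
                           (not-injective (∧-conicalʳ (valid (outcome c p M)) _ bad))
    ... | v , v∈C0 , no-stable3 = v , cong₂ _∧_ (badAt⇒isCrossMatrix c p M bad) (cong₂ _∧_ v∈C0 (cong not no-stable3))

  count-badAt≤ : ∀ L → 2 ≤ L → ∀ c p →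
                 count (badAt c p) (bipMatrices n) * 2 ^ L
                 ≤ 𝟙 (fewBlocks L c p) * crossCount c * 2 ^ L + n * (suc L ^ 2 * validCount c p)
  count-badAt≤ L 2≤L c p rewrite count-valid c p with C0-nonempty c ∧ isPartition c p in nonempty∧partition
  ... | false = ≤-trans (≤-reflexive (cong (_* 2 ^ L) no-bad)) z≤n
    where
    invalid : ∀ M → valid (outcome c p M) ≡ false
    invalid M = trans (sym (∧-assoc (C0-nonempty c) (isPartition c p) (isCrossMatrix c M)))
                      (cong (_∧ isCrossMatrix c M) nonempty∧partition)
    no-bad : count (badAt c p) (bipMatrices n) ≡ 0
    no-bad = trans (count-cong (bipMatrices n) (λ M → cong (_∧ not (goodEvent (outcome c p M))) (invalid M)))
                   (count-false (bipMatrices n))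
  ... | true with ∧-conicalʳ (C0-nonempty c) _ nonempty∧partition
  ...   | partition with blockCount c p <ᵇ L in few
  ...     | true  = ≤-trans (*-monoˡ-≤ (2 ^ L) bad≤cross) (m≤m+n _ _)
    where
    bad≤cross : count (badAt c p) (bipMatrices n) ≤ 𝟙 (isPartition c p ∧ true) * crossCount c
    bad≤cross = ≤-trans (count-mono (bipMatrices n) (badAt⇒isCrossMatrix c p))
                        (≤-reflexive (sym (trans (cong (λ b → 𝟙 (b ∧ true) * crossCount c) partition) (+-identityʳ _))))
  ...     | false = ≤-trans (count-badAt≤-manyBlocks L 2≤L c p (<ᵇ≡false⇒≥ _ L few))
                            (≤-trans (≤-reflexive (cong (λ k → n * (suc L ^ 2 * k)) (sym (+-identityʳ (crossCount c)))))
                                     (m≤n+m _ _))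

-- Partitions with few blocks are rare

module _ {n : ℕ} where

  repsWithin : ℕ → Vec Bool n → Vec (Fin n) n → Bool
  repsWithin L R p = (∣ lookup R ∣ <ᵇ L) ∧ ⋀ (λ v → lookup R (lookup p v) ∨ (lookup p v == v))

  count-repsWithin≤ : ∀ L R → count (repsWithin L R) (repVecs n) ≤ L ^ n
  count-repsWithin≤ L R with ∣ lookup R ∣ <ᵇ L in few
  ... | false rewrite count-false (repVecs n) = z≤n
  ... | true  = begin
    count (λ p → ⋀ (λ v → choice v (lookup p v))) (repVecs n) ≡⟨ count-vecsOf-⋀ (allFin n) n choice ⟩
    ∏ (λ v → count (choice v) (allFin n))                     ≤⟨ ∏-mono {n} choices≤L ⟩
    ∏ {n} (λ _ → L)                                           ≡⟨ ∏-const {n} L ⟩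
    L ^ n                                                     ∎
    where
    open ≤-Reasoning
    choice : Fin n → Fin n → Bool
    choice v x = lookup R x ∨ (x == v)
    choices≤L : ∀ v → count (choice v) (allFin n) ≤ L
    choices≤L v = begin
      count (choice v) (allFin n)             ≡⟨ count-tabulate (choice v) id ⟩
      ∣ choice v ∣                            ≤⟨ ∣∣-∨ (lookup R) (_== v) ⟩
      ∣ lookup R ∣ + ∣ (λ x → x == v) ∣       ≡⟨ cong (∣ lookup R ∣ +_) (∣==∣≡1 v) ⟩
      ∣ lookup R ∣ + 1                        ≡⟨ +-comm _ 1 ⟩
      suc ∣ lookup R ∣                        ≤⟨ <ᵇ≡true⇒< few ⟩
      L                                       ∎

  partition⇒rep∈reps : ∀ (c : Vec Bool n) p → isPartition c p ≡ true →
                       ∀ v → isRep c p (lookup p v) ∨ (lookup p v == v) ≡ true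
  partition⇒rep∈reps c p partition v = by-membership (lookup c v) refl
    where
    at-v : partitionAt c p v ≡ true
    at-v = all-allFin-elim {P = partitionAt c p} partition v
    by-membership : ∀ b → lookup c v ≡ b → isRep c p (lookup p v) ∨ (lookup p v == v) ≡ true
    by-membership true  v∈C0 rewrite trans (sym (if-true _ _ v∈C0)) at-v = ∨-zeroʳ (isRep c p (lookup p v))
    by-membership false v∉C0 =
      cong (_∨ (lookup p v == v)) (cong₂ _∧_ (∧-conicalˡ pv-outside _ outside) (∧-conicalʳ pv≤v _ (∧-conicalʳ pv-outside _ outside)))
      where
      pv-outside = not (lookup c (lookup p v))
      pv≤v = toℕ (lookup p v) ≤ᵇ toℕ v
      pv-fixed = lookup p (lookup p v) == lookup p v
      outside : pv-outside ∧ pv≤v ∧ pv-fixed ≡ true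
      outside = trans (sym (if-false (lookup p v == v) _ v∉C0)) at-v

  -- A partition is determined by its set of representatives R and the map v ↦ rep v ∈ R ∪ {v}.
  count-fewBlocks≤ : ∀ L (c : Vec Bool n) → count (fewBlocks L c) (repVecs n) ≤ 2 ^ n * L ^ n
  count-fewBlocks≤ L c = begin
    count (fewBlocks L c) (repVecs n)
      ≡⟨ count≡sumMap𝟙 (fewBlocks L c) (repVecs n) ⟩
    sumMap (𝟙 ∘ fewBlocks L c) (repVecs n)
      ≤⟨ sumMap-mono (repVecs n) fewBlocks≤reps ⟩
    sumMap (λ p → sumMap (λ R → 𝟙 (repsWithin L R p)) (inC0Vecs n)) (repVecs n)
      ≡⟨ sumMap-swap (λ p R → 𝟙 (repsWithin L R p)) (repVecs n) (inC0Vecs n) ⟩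
    sumMap (λ R → sumMap (𝟙 ∘ repsWithin L R) (repVecs n)) (inC0Vecs n)
      ≤⟨ sumMap-mono (inC0Vecs n) per-R ⟩
    sumMap (λ _ → L ^ n) (inC0Vecs n)
      ≡⟨ sumMap-vecsOf-bools-const n (L ^ n) ⟩
    2 ^ n * L ^ n ∎
    where
    open ≤-Reasoning
    reps-of : Vec (Fin n) n → Vec Bool n
    reps-of p = tabulate (isRep c p)
    fewBlocks⇒repsWithin : ∀ p → fewBlocks L c p ≡ true → repsWithin L (reps-of p) p ≡ true
    fewBlocks⇒repsWithin p few = cong₂ _∧_ few-reps (⋀-intro rep∈reps)
      where
      few-reps : (∣ lookup (reps-of p) ∣ <ᵇ L) ≡ true
      few-reps = trans (cong (_<ᵇ L) (∑-cong (λ i → cong 𝟙 (lookup∘tabulate (isRep c p) i))))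
                       (∧-conicalʳ (isPartition c p) _ few)
      rep∈reps : ∀ v → lookup (reps-of p) (lookup p v) ∨ (lookup p v == v) ≡ true
      rep∈reps v rewrite lookup∘tabulate (isRep c p) (lookup p v) =
        partition⇒rep∈reps c p (∧-conicalˡ (isPartition c p) _ few) v
    fewBlocks≤reps : ∀ p → 𝟙 (fewBlocks L c p) ≤ sumMap (λ R → 𝟙 (repsWithin L R p)) (inC0Vecs n)
    fewBlocks≤reps p with fewBlocks L c p in few
    ... | false = z≤n
    ... | true  = subst (_≤ _) (cong 𝟙 (fewBlocks⇒repsWithin p few))
                        (≤-sumMap-vecsOf-bools (λ R → 𝟙 (repsWithin L R p)) (reps-of p))
    per-R : ∀ R → sumMap (𝟙 ∘ repsWithin L R) (repVecs n) ≤ L ^ n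
    per-R R = subst (_≤ L ^ n) (count≡sumMap𝟙 (repsWithin L R) (repVecs n)) (count-repsWithin≤ L R)

-- A lower bound on the number of outcomes

∏-if-1 : ∀ {n} (P : Fin n → Bool) h → ∏ (λ v → if P v then 1 else h) ≡ h ^ ∣ not ∘ P ∣
∏-if-1 P h = trans (∏-cong (λ v → by-cases (P v))) (∏-^ h (λ v → 𝟙 (not (P v))))
  where
  by-cases : ∀ b → (if b then 1 else h) ≡ h ^ 𝟙 (not b)
  by-cases true  = refl
  by-cases false = sym (*-identityʳ h)

module _ {n : ℕ} where

  initialSegment : ℕ → Vec Bool n
  initialSegment a = tabulate (λ i → toℕ i <ᵇ a)

  ∣initialSegment∣ : ∀ a → a ≤ n → ∣ lookup (initialSegment a) ∣ ≡ a
  ∣initialSegment∣ a a≤n =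
    trans (∑-cong {n} (λ i → cong 𝟙 (lookup∘tabulate (λ i → toℕ i <ᵇ a) i))) (∣<ᵇ∣≡ n a a≤n)

  initialSegment-nonempty : ∀ a → 1 ≤ a → 1 ≤ n → C0-nonempty (initialSegment a) ≡ true
  initialSegment-nonempty (suc a) _ (s≤s _) =
    trans (any-tabulate (lookup (initialSegment (suc a))) id) (⋁-intro {P = lookup (initialSegment (suc a))} fzero refl)

  crossCount-initialSegment : ∀ a → a ≤ n → crossCount (initialSegment a) ≡ 2 ^ (a * (n ∸ a))
  crossCount-initialSegment a a≤n rewrite crossCount≡2^ (initialSegment a)
                                        | ∣not∣≡n∸∣∣ (lookup (initialSegment a)) | ∣initialSegment∣ a a≤n = refl

  -- The partitions with C₀ = [0, a), singleton blocks [a, t), and every vertex from t on joining one of them.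
  starChoice : ℕ → ℕ → Fin n → Fin n → Bool
  starChoice a t v x = if toℕ v <ᵇ t then x == v else ((toℕ x <ᵇ t) ∧ not (toℕ x <ᵇ a))

  isStar : ℕ → ℕ → Vec (Fin n) n → Bool
  isStar a t p = ⋀ (λ v → starChoice a t v (lookup p v))

  isStar⇒isPartition : ∀ a t p → a ≤ t → isStar a t p ≡ true → isPartition (initialSegment a) p ≡ true
  isStar⇒isPartition a t p a≤t star = trans (all-tabulate (partitionAt (initialSegment a) p) id) (⋀-intro ok)
    where
    chosen : ∀ v → starChoice a t v (lookup p v) ≡ true
    chosen = ⋀-elim star
    ok : ∀ v → partitionAt (initialSegment a) p v ≡ true
    ok v rewrite lookup∘tabulate (λ i → toℕ i <ᵇ a) v | lookup∘tabulate (λ i → toℕ i <ᵇ a) (lookup p v)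
      with toℕ v <ᵇ a in v<a | toℕ v <ᵇ t in v<t | chosen v
    ... | true  | true  | pv==v = pv==v
    ... | true  | false | _     =
      ⊥-elim (<-irrefl refl (<-≤-trans (<ᵇ≡true⇒< v<a) (≤-trans a≤t (<ᵇ≡false⇒≥ (toℕ v) t v<t))))
    ... | false | true  | pv==v =
      cong₂ _∧_ (trans (cong (λ x → not (toℕ x <ᵇ a)) pv≡v) (cong not v<a))
                (cong₂ _∧_ (≤⇒≤ᵇ≡true (≤-reflexive (cong toℕ pv≡v))) (≡⇒== (cong (lookup p) pv≡v)))
      where
      pv≡v = ==⇒≡ pv==v
    ... | false | false | in-range =
      cong₂ _∧_ (∧-conicalʳ (toℕ (lookup p v) <ᵇ t) _ in-range)
                (cong₂ _∧_ (≤⇒≤ᵇ≡true (<⇒≤ (<-≤-trans (<ᵇ≡true⇒< pv<t) (<ᵇ≡false⇒≥ (toℕ v) t v<t))))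
                           (trans (sym (if-true {b = toℕ (lookup p v) <ᵇ t} (lookup p (lookup p v) == lookup p v) _ pv<t))
                                  (chosen (lookup p v))))
      where
      pv<t = ∧-conicalˡ _ _ in-range

  count-starChoice : ∀ a h v → a + h ≤ n →
                     count (starChoice a (a + h) v) (allFin n) ≡ (if toℕ v <ᵇ a + h then 1 else h)
  count-starChoice a h v a+h≤n rewrite count-tabulate (starChoice a (a + h) v) id with toℕ v <ᵇ a + h
  ... | true  = ∣==∣≡1 v
  ... | false = trans (∣interval∣≡ n a (a + h) (m≤m+n a h) a+h≤n) (m+n∸m≡n a h)

  count-isStar : ∀ a h → a + h ≤ n → count (isStar a (a + h)) (repVecs n) ≡ h ^ (n ∸ (a + h))
  count-isStar a h a+h≤n = begin
    count (isStar a (a + h)) (repVecs n)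
      ≡⟨ count-vecsOf-⋀ (allFin n) n (starChoice a (a + h)) ⟩
    ∏ (λ v → count (starChoice a (a + h) v) (allFin n))
      ≡⟨ ∏-cong {n} (λ v → count-starChoice a h v a+h≤n) ⟩
    ∏ {n} (λ v → if toℕ v <ᵇ a + h then 1 else h)
      ≡⟨ ∏-if-1 {n} (λ v → toℕ v <ᵇ a + h) h ⟩
    h ^ ∣ (λ (v : Fin n) → not (toℕ v <ᵇ a + h)) ∣
      ≡⟨ cong (h ^_) (trans (∣not∣≡n∸∣∣ {n} (λ v → toℕ v <ᵇ a + h)) (cong (n ∸_) (∣<ᵇ∣≡ n (a + h) a+h≤n))) ⟩
    h ^ (n ∸ (a + h)) ∎
    where open ≡-Reasoning

totalCount≡ : ∀ n → totalCount n ≡ sumCP n validCount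
totalCount≡ n = count-allOutcomes n valid

totalCount≥ : ∀ n a h → 1 ≤ a → a + h ≤ n → h ^ (n ∸ (a + h)) * crossCount (initialSegment {n} a) ≤ totalCount n
totalCount≥ n a h 1≤a a+h≤n = begin
  h ^ (n ∸ (a + h)) * crossCount c*
    ≡⟨ cong (_* crossCount c*) (count-isStar a h a+h≤n) ⟨
  count (isStar a (a + h)) (repVecs n) * crossCount c*
    ≡⟨ cong (_* crossCount c*) (count≡sumMap𝟙 (isStar a (a + h)) (repVecs n)) ⟩
  sumMap (𝟙 ∘ isStar a (a + h)) (repVecs n) * crossCount c*
    ≡⟨ sumMap-*ʳ (crossCount c*) (𝟙 ∘ isStar a (a + h)) (repVecs n) ⟨
  sumMap (λ p → 𝟙 (isStar a (a + h) p) * crossCount c*) (repVecs n)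
    ≤⟨ sumMap-mono (repVecs n) (λ p → *-monoˡ-≤ (crossCount c*) (𝟙-mono (star⇒valid p))) ⟩
  sumMap (λ p → 𝟙 (C0-nonempty c* ∧ isPartition c* p) * crossCount c*) (repVecs n)
    ≡⟨ sumMap-cong (repVecs n) (λ p → count-valid c* p) ⟨
  sumMap (validCount c*) (repVecs n)
    ≤⟨ ≤-sumMap-vecsOf-bools (λ c → sumMap (validCount c) (repVecs n)) c* ⟩
  sumCP n validCount
    ≡⟨ totalCount≡ n ⟨
  totalCount n ∎
  where
  open ≤-Reasoning
  c* = initialSegment {n} a
  star⇒valid : ∀ p → isStar a (a + h) p ≡ true → C0-nonempty c* ∧ isPartition c* p ≡ true
  star⇒valid p star = cong₂ _∧_ (initialSegment-nonempty a 1≤a (≤-trans 1≤a (≤-trans (m≤m+n a h) a+h≤n)))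
                                (isStar⇒isPartition a (a + h) p (m≤m+n a h) star)

badCount*2^L≤ : ∀ n L → 2 ≤ L →
                badCount n * 2 ^ L ≤ 2 ^ n * (2 ^ n * L ^ n) * 2 ^ (⌊ n /2⌋ * ⌈ n /2⌉) * 2 ^ L + n * suc L ^ 2 * totalCount n
badCount*2^L≤ n L 2≤L = begin
  badCount n * 2 ^ L                                             ≡⟨ cong (_* 2 ^ L) (count-allOutcomes n _) ⟩
  sumCP n (λ c p → count (badAt c p) (bipMatrices n)) * 2 ^ L    ≡⟨ sumCP-*ʳ {n} (2 ^ L) _ ⟨
  sumCP n (λ c p → count (badAt c p) (bipMatrices n) * 2 ^ L)    ≤⟨ sumCP-mono {n} (count-badAt≤ L 2≤L) ⟩
  sumCP n (λ c p → few c p + n * (suc L ^ 2 * validCount c p))   ≡⟨ sumCP-+ {n} few _ ⟩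
  sumCP n few + sumCP n (λ c p → n * (suc L ^ 2 * validCount c p)) ≡⟨ cong (sumCP n few +_) many-part ⟩
  sumCP n few + n * suc L ^ 2 * totalCount n                     ≤⟨ +-monoˡ-≤ _ few-part ⟩
  F * X * 2 ^ L + n * suc L ^ 2 * totalCount n                   ∎
  where
  open ≤-Reasoning
  F = 2 ^ n * (2 ^ n * L ^ n)
  X = 2 ^ (⌊ n /2⌋ * ⌈ n /2⌉)
  few : Vec Bool n → Vec (Fin n) n → ℕ
  few c p = 𝟙 (fewBlocks L c p) * crossCount c * 2 ^ L
  many-part : sumCP n (λ c p → n * (suc L ^ 2 * validCount c p)) ≡ n * suc L ^ 2 * totalCount n
  many-part = begin-equality
    sumCP n (λ c p → n * (suc L ^ 2 * validCount c p))  ≡⟨ sumCP-*ˡ {n} n _ ⟩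
    n * sumCP n (λ c p → suc L ^ 2 * validCount c p)    ≡⟨ cong (n *_) (sumCP-*ˡ {n} (suc L ^ 2) validCount) ⟩
    n * (suc L ^ 2 * sumCP n validCount)                ≡⟨ cong (λ t → n * (suc L ^ 2 * t)) (totalCount≡ n) ⟨
    n * (suc L ^ 2 * totalCount n)                      ≡⟨ *-assoc n (suc L ^ 2) (totalCount n) ⟨
    n * suc L ^ 2 * totalCount n                        ∎
  per-c : ∀ c → sumMap (few c) (repVecs n) ≤ 2 ^ n * L ^ n * (X * 2 ^ L)
  per-c c = begin
    sumMap (few c) (repVecs n)
      ≤⟨ sumMap-mono (repVecs n) (λ p → ≤-reflexive (*-assoc (𝟙 (fewBlocks L c p)) _ _)) ⟩
    sumMap (λ p → 𝟙 (fewBlocks L c p) * (crossCount c * 2 ^ L)) (repVecs n)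
      ≤⟨ sumMap-mono (repVecs n) (λ p → *-monoʳ-≤ (𝟙 (fewBlocks L c p)) (*-monoˡ-≤ (2 ^ L) (crossCount≤2^⌊n/2⌋⌈n/2⌉ c))) ⟩
    sumMap (λ p → 𝟙 (fewBlocks L c p) * (X * 2 ^ L)) (repVecs n)
      ≡⟨ sumMap-*ʳ (X * 2 ^ L) (𝟙 ∘ fewBlocks L c) (repVecs n) ⟩
    sumMap (𝟙 ∘ fewBlocks L c) (repVecs n) * (X * 2 ^ L)
      ≡⟨ cong (_* (X * 2 ^ L)) (count≡sumMap𝟙 (fewBlocks L c) (repVecs n)) ⟨
    count (fewBlocks L c) (repVecs n) * (X * 2 ^ L)
      ≤⟨ *-monoˡ-≤ (X * 2 ^ L) (count-fewBlocks≤ L c) ⟩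
    2 ^ n * L ^ n * (X * 2 ^ L) ∎
  few-part : sumCP n few ≤ F * X * 2 ^ L
  few-part = begin
    sumCP n few                                          ≤⟨ sumMap-mono (inC0Vecs n) per-c ⟩
    sumMap (λ _ → 2 ^ n * L ^ n * (X * 2 ^ L)) (inC0Vecs n) ≡⟨ sumMap-vecsOf-bools-const n _ ⟩
    2 ^ n * (2 ^ n * L ^ n * (X * 2 ^ L))                ≡⟨ regroup (2 ^ n) (2 ^ n) (L ^ n) X (2 ^ L) ⟩
    F * X * 2 ^ L                                        ∎
    where
    regroup : ∀ a b c d e → a * (b * c * (d * e)) ≡ a * (b * c) * d * e
    regroup = solve-∀

absorb : ∀ k B T P F X W m .{{_ : NonZero P}} →
         B * P ≤ F * X * P + m * T → 2 * k * F ≤ W → W * X ≤ T → 2 * k * m ≤ P → k * B ≤ T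
absorb k B T P F X W m BP≤ 2kF≤W WX≤T 2km≤P = *-cancelˡ-≤ 2 (*-cancelʳ-≤ (2 * (k * B)) (2 * T) P (begin
  2 * (k * B) * P                     ≡⟨ regroup₁ k B P ⟩
  2 * k * (B * P)                     ≤⟨ *-monoʳ-≤ (2 * k) BP≤ ⟩
  2 * k * (F * X * P + m * T)         ≡⟨ regroup₂ k F X P m T ⟩
  2 * k * F * X * P + 2 * k * m * T   ≤⟨ +-mono-≤ (*-monoˡ-≤ P (*-monoˡ-≤ X 2kF≤W)) (*-monoˡ-≤ T 2km≤P) ⟩
  W * X * P + P * T                   ≤⟨ +-monoˡ-≤ (P * T) (*-monoˡ-≤ P WX≤T) ⟩
  T * P + P * T                       ≡⟨ regroup₃ T P ⟩
  2 * T * P                           ∎))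
  where
  open ≤-Reasoning
  regroup₁ : ∀ k B P → 2 * (k * B) * P ≡ 2 * k * (B * P)
  regroup₁ = solve-∀
  regroup₂ : ∀ k F X P m T → 2 * k * (F * X * P + m * T) ≡ 2 * k * F * X * P + 2 * k * m * T
  regroup₂ = solve-∀
  regroup₃ : ∀ T P → T * P + P * T ≡ 2 * T * P
  regroup₃ = solve-∀

-- With totalCount≥, the two conditions make each term of badCount*2^L≤ at most totalCount n * 2 ^ L / (2 k).
k*badCount≤totalCount : ∀ n k L h → 2 ≤ L → 1 ≤ ⌊ n /2⌋ → ⌊ n /2⌋ + h ≤ n →
                        2 * k * (n * suc L ^ 2) ≤ 2 ^ L → 2 * k * (2 ^ n * (2 ^ n * L ^ n)) ≤ h ^ (n ∸ (⌊ n /2⌋ + h)) →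
                        k * badCount n ≤ totalCount n
k*badCount≤totalCount n k L h 2≤L 1≤a a+h≤n 2kn[1+L]²≤2^L 2k[4L]ⁿ≤hᵐ =
  absorb k (badCount n) (totalCount n) (2 ^ L) (2 ^ n * (2 ^ n * L ^ n)) (2 ^ (a * ⌈ n /2⌉)) (h ^ (n ∸ (a + h))) (n * suc L ^ 2)
         {{m^n≢0 2 L}} (badCount*2^L≤ n L 2≤L) 2k[4L]ⁿ≤hᵐ
         (subst (λ X → h ^ (n ∸ (a + h)) * X ≤ totalCount n) crossCount-balanced (totalCount≥ n a h 1≤a a+h≤n))
         2kn[1+L]²≤2^L
  where
  a = ⌊ n /2⌋
  crossCount-balanced : crossCount (initialSegment {n} a) ≡ 2 ^ (a * ⌈ n /2⌉)
  crossCount-balanced = trans (crossCount-initialSegment a (⌊n/2⌋≤n n))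
                              (cong (λ m → 2 ^ (a * m)) (trans (cong (_∸ a) (sym (⌊n/2⌋+⌈n/2⌉≡n n))) (m+n∸m≡n a ⌈ n /2⌉)))

-- Choosing the number of blocks

^-distribʳ-* : ∀ a b n → (a * b) ^ n ≡ a ^ n * b ^ n
^-distribʳ-* a b zero    = refl
^-distribʳ-* a b (suc n) rewrite ^-distribʳ-* a b n = interchange a b (a ^ n) (b ^ n)
  where
  interchange : ∀ a b x y → a * b * (x * y) ≡ a * x * (b * y)
  interchange = solve-∀

n<2^n : ∀ n → n < 2 ^ n
n<2^n zero    = s≤s z≤n
n<2^n (suc n) = begin-strict
  suc n           <⟨ s≤s (n<2^n n) ⟩
  suc (2 ^ n)     ≤⟨ +-monoˡ-≤ (2 ^ n) (m^n>0 2 n) ⟩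
  2 ^ n + 2 ^ n   ≡⟨ cong (2 ^ n +_) (+-identityʳ (2 ^ n)) ⟨
  2 ^ suc n       ∎
  where open ≤-Reasoning

[4+d]²≤2^[4+d] : ∀ d → (4 + d) * (4 + d) ≤ 2 ^ (4 + d)
[4+d]²≤2^[4+d] zero    = ≤-refl
[4+d]²≤2^[4+d] (suc d) = begin
  (5 + d) * (5 + d)
    ≡⟨ expand d ⟩
  (4 + d) * (4 + d) + (9 + 2 * d)
    ≤⟨ +-monoʳ-≤ ((4 + d) * (4 + d)) (≤-trans (m≤m+n (9 + 2 * d) (7 + 6 * d + d * d)) (≤-reflexive (collect d))) ⟩
  (4 + d) * (4 + d) + (4 + d) * (4 + d)
    ≤⟨ +-mono-≤ ([4+d]²≤2^[4+d] d) (≤-trans ([4+d]²≤2^[4+d] d) (≤-reflexive (sym (+-identityʳ _)))) ⟩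
  2 ^ (5 + d) ∎
  where
  open ≤-Reasoning
  expand : ∀ d → (5 + d) * (5 + d) ≡ (4 + d) * (4 + d) + (9 + 2 * d)
  expand = solve-∀
  collect : ∀ d → 9 + 2 * d + (7 + 6 * d + d * d) ≡ (4 + d) * (4 + d)
  collect = solve-∀

linear≤2^ : ∀ A B s → A + B + 4 ≤ s → A * s + B ≤ 2 ^ s
linear≤2^ A B s A+B+4≤s with m≤n⇒∃[o]m+o≡n (≤-trans (m≤n+m 4 (A + B)) A+B+4≤s)
... | d , refl = begin
  A * (4 + d) + B               ≤⟨ +-monoʳ-≤ (A * (4 + d)) (m≤m*n B (4 + d)) ⟩
  A * (4 + d) + B * (4 + d)     ≡⟨ *-distribʳ-+ (4 + d) A B ⟨
  (A + B) * (4 + d)             ≤⟨ *-monoˡ-≤ (4 + d) (≤-trans (m≤m+n (A + B) 4) A+B+4≤s) ⟩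
  (4 + d) * (4 + d)             ≤⟨ [4+d]²≤2^[4+d] d ⟩
  2 ^ (4 + d)                   ∎
  where open ≤-Reasoning

bracket : (f : ℕ → ℕ) → (∀ s → s < f s) → ∀ {s₀ n} → f s₀ ≤ n → ∃[ s ] (s₀ ≤ s × f s ≤ n × n < f (suc s))
bracket f s<fs {s₀} {n} fs₀≤n = search n s₀ fs₀≤n (≤-<-trans (m≤m+n n s₀) (s<fs (n + s₀)))
  where
  search : ∀ fuel s → f s ≤ n → n < f (fuel + s) → ∃[ s′ ] (s ≤ s′ × f s′ ≤ n × n < f (suc s′))
  search zero       s fs≤n n<fs = ⊥-elim (<-irrefl refl (<-≤-trans n<fs fs≤n))
  search (suc fuel) s fs≤n n<f with n <? f (suc s)
  ... | yes n<fs′ = s , ≤-refl , fs≤n , n<fs′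
  ... | no  n≮fs′ with search fuel (suc s) (≮⇒≥ n≮fs′) (subst (λ t → n < f t) (sym (+-suc fuel s)) n<f)
  ...   | s′ , s<s′ , fs′≤n , n<fs′ = s′ , ≤-trans (n≤1+n s) s<s′ , fs′≤n , n<fs′

quarter : ℕ → ℕ
quarter n = ⌊ ⌈ n /2⌉ /2⌋

module _ (n : ℕ) where

  private
    a = ⌊ n /2⌋
    a′ = ⌈ n /2⌉
    halves : a + a′ ≡ n
    halves = ⌊n/2⌋+⌈n/2⌉≡n n
    quarters : quarter n + ⌈ a′ /2⌉ ≡ a′
    quarters = ⌊n/2⌋+⌈n/2⌉≡n a′

  ⌊n/2⌋+quarter≤n : a + quarter n ≤ n
  ⌊n/2⌋+quarter≤n = ≤-trans (+-monoʳ-≤ a (⌊n/2⌋≤n a′)) (≤-reflexive halves)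

  n≤4*quarter+2 : n ≤ 4 * quarter n + 2
  n≤4*quarter+2 = begin
    n
      ≡⟨ halves ⟨
    a + a′
      ≤⟨ +-monoˡ-≤ a′ (⌊n/2⌋≤⌈n/2⌉ n) ⟩
    a′ + a′
      ≡⟨ cong (λ x → x + x) quarters ⟨
    (h + ⌈ a′ /2⌉) + (h + ⌈ a′ /2⌉)
      ≤⟨ +-mono-≤ (+-monoʳ-≤ h (⌈n/2⌉≤1+⌊n/2⌋ a′)) (+-monoʳ-≤ h (⌈n/2⌉≤1+⌊n/2⌋ a′)) ⟩
    (h + suc h) + (h + suc h)
      ≡⟨ collect h ⟩
    4 * h + 2 ∎
    where
    open ≤-Reasoning
    h = quarter n
    collect : ∀ h → (h + suc h) + (h + suc h) ≡ 4 * h + 2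
    collect = solve-∀

  quarter≤n∸[⌊n/2⌋+quarter] : quarter n ≤ n ∸ (a + quarter n)
  quarter≤n∸[⌊n/2⌋+quarter] = begin
    quarter n                            ≤⟨ ⌊n/2⌋≤⌈n/2⌉ a′ ⟩
    ⌈ a′ /2⌉                             ≡⟨ m+n∸m≡n (a + quarter n) _ ⟨
    a + quarter n + ⌈ a′ /2⌉ ∸ (a + quarter n) ≡⟨ cong (_∸ (a + quarter n)) rest ⟩
    n ∸ (a + quarter n)                  ∎
    where
    open ≤-Reasoning
    rest : a + quarter n + ⌈ a′ /2⌉ ≡ n
    rest = trans (+-assoc a (quarter n) _) (trans (cong (a +_) quarters) halves)

m≤m^[1+j] : ∀ m j → 1 ≤ m → m ≤ m ^ suc j
m≤m^[1+j] m j 1≤m = ≤-trans (≤-reflexive (sym (*-identityʳ m))) (*-monoʳ-≤ m (≤-trans (≤-reflexive (sym (^-zeroˡ j))) (^-monoˡ-≤ j 1≤m)))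

-- Choosing L = 2^s with threshold k s ≤ n < threshold k (1 + s) makes L a fixed power of n (L⁵ ≈ n),
-- which is large enough for the first condition of k*badCount≤totalCount and small enough for the second.
threshold : ℕ → ℕ → ℕ
threshold k s = 8 * k * (2 ^ (2 + s)) ^ 5 + 2

s<threshold : ∀ k → 1 ≤ k → ∀ s → s < threshold k s
s<threshold k 1≤k s = begin-strict
  s                              <⟨ n<2^n s ⟩
  2 ^ s                          ≤⟨ ^-monoʳ-≤ 2 (m≤n+m s 2) ⟩
  2 ^ (2 + s)                    ≤⟨ m≤m^[1+j] (2 ^ (2 + s)) 4 (m^n>0 2 (2 + s)) ⟩
  (2 ^ (2 + s)) ^ 5              ≤⟨ m≤n*m _ (8 * k) {{>-nonZero (≤-trans (s≤s z≤n) (*-monoʳ-≤ 8 1≤k))}} ⟩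
  8 * k * (2 ^ (2 + s)) ^ 5      ≤⟨ m≤m+n _ 2 ⟩
  threshold k s                  ∎
  where open ≤-Reasoning

2²²k²L⁷≤2^L : ∀ k s → 33 + (k + k) ≤ s → 2 ^ 22 * (k * k) * (2 ^ s) ^ 7 ≤ 2 ^ (2 ^ s)
2²²k²L⁷≤2^L k s s-large = begin
  2 ^ 22 * (k * k) * (2 ^ s) ^ 7
    ≤⟨ *-monoˡ-≤ ((2 ^ s) ^ 7) (*-monoʳ-≤ (2 ^ 22) (*-mono-≤ (<⇒≤ (n<2^n k)) (<⇒≤ (n<2^n k)))) ⟩
  2 ^ 22 * (2 ^ k * 2 ^ k) * (2 ^ s) ^ 7
    ≡⟨ as-power 22 ⟩
  2 ^ (7 * s + (22 + (k + k)))
    ≤⟨ ^-monoʳ-≤ 2 (linear≤2^ 7 (22 + (k + k)) s (≤-trans (≤-reflexive (+-comm _ 4)) s-large)) ⟩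
  2 ^ (2 ^ s) ∎
  where
  open ≤-Reasoning
  -- Stated for a variable exponent c (instantiated with 22) so that Agda never unfolds 2 ^ 22 * x.
  as-power : ∀ c → 2 ^ c * (2 ^ k * 2 ^ k) * (2 ^ s) ^ 7 ≡ 2 ^ (7 * s + (c + (k + k)))
  as-power c = begin-equality
    2 ^ c * (2 ^ k * 2 ^ k) * (2 ^ s) ^ 7
      ≡⟨ cong₂ (λ x y → 2 ^ c * x * y) (^-distribˡ-+-* 2 k k) (sym (^-*-assoc 2 s 7)) ⟨
    2 ^ c * 2 ^ (k + k) * 2 ^ (s * 7)
      ≡⟨ cong (_* 2 ^ (s * 7)) (^-distribˡ-+-* 2 c (k + k)) ⟨
    2 ^ (c + (k + k)) * 2 ^ (s * 7)
      ≡⟨ ^-distribˡ-+-* 2 (c + (k + k)) (s * 7) ⟨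
    2 ^ (c + (k + k) + s * 7)
      ≡⟨ cong (2 ^_) (trans (+-comm _ (s * 7)) (cong (_+ (c + (k + k))) (*-comm s 7))) ⟩
    2 ^ (7 * s + (c + (k + k))) ∎

2kn[1+L]²≤2²²k²L⁷ : ∀ k s n → 1 ≤ k → n < threshold k (suc s) → 2 * k * (n * suc (2 ^ s) ^ 2) ≤ 2 ^ 22 * (k * k) * (2 ^ s) ^ 7
2kn[1+L]²≤2²²k²L⁷ k s n 1≤k n<threshold =
  ≤-trans (*-monoʳ-≤ (2 * k) (*-mono-≤ n≤2Y (^-monoˡ-≤ 2 1+L≤2L))) (≤-reflexive (expand 2 k L))
  where
  L = 2 ^ s
  Y = 8 * k * (2 ^ (3 + s)) ^ 5
  1≤Y : 1 ≤ Y
  1≤Y = ≤-trans (s≤s z≤n) (*-mono-≤ (*-monoʳ-≤ 8 1≤k) (m^n>0 (2 ^ (3 + s)) {{m^n≢0 2 (3 + s)}} 5))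
  n≤2Y : n ≤ 2 * Y
  n≤2Y = ≤-trans (≤-pred (≤-trans n<threshold (≤-reflexive (+-comm Y 2))))
                 (≤-trans (+-monoˡ-≤ Y 1≤Y) (≤-reflexive (cong (Y +_) (sym (+-identityʳ Y)))))
  1+L≤2L : suc L ≤ 2 * L
  1+L≤2L = ≤-trans (≤-reflexive (+-comm 1 L)) (≤-trans (+-monoʳ-≤ L (m^n>0 2 s)) (≤-reflexive (cong (L +_) (sym (+-identityʳ L)))))
  -- Stated for a variable t (instantiated with 2) to keep the ring solver away from large literals.
  expand : ∀ t k L → let X = t * (t * (t * L)) in
           t * k * (t * (t * t * t * k * (X * (X * (X * (X * (X * 1)))))) * (t * L * (t * L * 1)))
           ≡ t * t * (t * t * t) * (t * t * t) * (t * t * t) * (t * t * t) * (t * t * t) * (t * t * t) * (t * t)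
             * (k * k) * (L * (L * (L * (L * (L * (L * (L * 1)))))))
  expand = solve-∀

2k[4L]ⁿ≤quarterᵐ : ∀ k s n → 1 ≤ k → threshold k s ≤ n →
                   2 * k * (2 ^ n * (2 ^ n * (2 ^ s) ^ n)) ≤ quarter n ^ (n ∸ (⌊ n /2⌋ + quarter n))
2k[4L]ⁿ≤quarterᵐ k s n 1≤k threshold≤n = begin
  2 * k * (2 ^ n * (2 ^ n * (2 ^ s) ^ n))
    ≡⟨ cong (2 * k *_) (trans (^-distribʳ-* 2 (2 * 2 ^ s) n) (cong (2 ^ n *_) (^-distribʳ-* 2 (2 ^ s) n))) ⟨
  2 * k * X ^ n
    ≤⟨ *-monoʳ-≤ (2 * k) (^-monoʳ-≤ X {{m^n≢0 2 (2 + s)}} n≤5h) ⟩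
  2 * k * X ^ (5 * h)
    ≡⟨ cong (2 * k *_) (^-*-assoc X 5 h) ⟨
  2 * k * (X ^ 5) ^ h
    ≤⟨ *-monoˡ-≤ ((X ^ 5) ^ h) 2k≤[2k]^h ⟩
  (2 * k) ^ h * (X ^ 5) ^ h
    ≡⟨ ^-distribʳ-* (2 * k) (X ^ 5) h ⟨
  (2 * k * X ^ 5) ^ h
    ≤⟨ ^-monoˡ-≤ h 2kX⁵≤h ⟩
  h ^ h
    ≤⟨ ^-monoʳ-≤ h {{>-nonZero (≤-trans (s≤s z≤n) 2≤h)}} (quarter≤n∸[⌊n/2⌋+quarter] n) ⟩
  h ^ (n ∸ (⌊ n /2⌋ + h)) ∎
  where
  open ≤-Reasoning
  X = 2 ^ (2 + s)
  h = quarter n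
  2kX⁵≤h : 2 * k * X ^ 5 ≤ h
  2kX⁵≤h = *-cancelˡ-≤ 4 (+-cancelʳ-≤ 2 _ _ (begin
    4 * (2 * k * X ^ 5) + 2    ≡⟨ cong (_+ 2) (regroup k (X ^ 5)) ⟩
    threshold k s              ≤⟨ threshold≤n ⟩
    n                          ≤⟨ n≤4*quarter+2 n ⟩
    4 * h + 2                  ∎))
    where
    regroup : ∀ k Y → 4 * (2 * k * Y) ≡ 8 * k * Y
    regroup = solve-∀
  2≤h : 2 ≤ h
  2≤h = ≤-trans (*-mono-≤ (*-monoʳ-≤ 2 1≤k) (m^n>0 X {{m^n≢0 2 (2 + s)}} 5)) 2kX⁵≤h
  n≤5h : n ≤ 5 * h
  n≤5h = ≤-trans (n≤4*quarter+2 n) (≤-trans (+-monoʳ-≤ (4 * h) 2≤h) (≤-reflexive (collect h)))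
    where
    collect : ∀ h → 4 * h + h ≡ 5 * h
    collect = solve-∀
  2k≤[2k]^h : 2 * k ≤ (2 * k) ^ h
  2k≤[2k]^h = subst (λ e → 2 * k ≤ (2 * k) ^ e) (suc-pred h {{>-nonZero (≤-trans (s≤s z≤n) 2≤h)}})
                    (m≤m^[1+j] (2 * k) (pred h) (≤-trans 1≤k (m≤m+n k (k + 0))))

lemma6 : (k : ℕ) → ∃[ N ] ((n : ℕ) → N ≤ n → k * badCount n ≤ totalCount n)
lemma6 zero      = 0 , λ _ _ → z≤n
lemma6 k@(suc _) = threshold k s₀ , λ n N≤n → from-bracket n (bracket (threshold k) (s<threshold k 1≤k) {s₀} {n} N≤n)
  where
  1≤k : 1 ≤ k
  1≤k = s≤s z≤n
  -- Given explicitly to bracket: inferring s₀ from N≤n would make Agda unfold 2 ^ s₀.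
  s₀ = 33 + (k + k)
  from-bracket : ∀ n → ∃[ s ] (s₀ ≤ s × threshold k s ≤ n × n < threshold k (suc s)) → k * badCount n ≤ totalCount n
  from-bracket n (s , s₀≤s , threshold≤n , n<threshold) =
    k*badCount≤totalCount n k (2 ^ s) (quarter n) 2≤2^s 1≤⌊n/2⌋ (⌊n/2⌋+quarter≤n n)
      (≤-trans (2kn[1+L]²≤2²²k²L⁷ k s n 1≤k n<threshold) (2²²k²L⁷≤2^L k s s₀≤s))
      (2k[4L]ⁿ≤quarterᵐ k s n 1≤k threshold≤n)
    where
    2≤2^s : 2 ≤ 2 ^ s
    2≤2^s = ^-monoʳ-≤ 2 {1} (≤-trans (s≤s z≤n) s₀≤s)
    1≤⌊n/2⌋ : 1 ≤ ⌊ n /2⌋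
    1≤⌊n/2⌋ = ⌊n/2⌋-mono (≤-trans (m≤n+m 2 _) threshold≤n)
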